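{- Let $G$ be a threshold graph on $\{0,1,\dots,n\}$ labeled by reverse degree sequence, with edges directed from $i$ to $j$ when $i>j$, degree sequence $(d_0,\dots,d_n)$, and let $\mathbf a=(a_1,\dots,a_n)\in\mathbb Z_{>0}^n$. Then \[\operatorname{Ehr}_{q,0}(\mathcal F_G(\mathbf a))=\prod_{i=1}^n q^{\bar d_i(a_i-1)}[\bar d_i]_q,\] where $\bar d_i=\min\{d_i,i\}$.
   Context: A threshold graph is built from one vertex by repeatedly adding a dominating vertex or an isolated vertex; labeled by reverse degree sequence means $d_i\ge d_j$ for $i<j$; $\bar d_i$ is the number of neighbors $j<i$ of $i$. $\mathcal F_G(\mathbf a)$ is the set of $x\in\mathbb R_{\ge0}^E$ such that for each vertex $k\ge1$ the flow out of $k$ (on edges to smaller vertices) minus the flow into $k$ equals $a_k$, and the net flow at $0$ is $-\sum a_i$. $wt_{q,t}(b)=\frac{q^b-t^b}{q-t}$ for $b>0$, $wt_{q,t}(0)=1$; for an integer flow $A=(a_{ij})$, $wt_{q,t}(A)=(-(1-t)(1-q))^{\#\{a_{ij}>0\}-n}\prod wt_{q,t}(a_{ij})$; $\operatorname{Ehr}_{q,t}(\mathcal F_G(\mathbf a))=\sum_{A\in\mathcal F_G(\mathbf a)\cap\mathbb Z^E}wt_{q,t}(A)$. $[k]_q=1+q+\dots+q^{k-1}$ (so $[0]_q=0$). -}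

module Defs where

open import Data.Bool using (Bool; true; false; if_then_else_; _∧_; not)
open import Data.Nat as ℕ using (ℕ; zero; suc; _∸_; _<ᵇ_; _≡ᵇ_; _⊔_; _⊓_)
open import Data.Integer as ℤ using (ℤ; +_; -_)
open import Data.Fin using (Fin; toℕ; zero; suc)
open import Data.List using (List; []; _∷_; map; filterᵇ; concatMap; allFin; upTo; length; foldr; zip)
open import Data.Bool.ListAction using (and)
open import Data.Product using (Σ; _×_; _,_; proj₁; proj₂)
open import Function.Bundles using (_↔_; Inverse)
open import Relation.Binary.PropositionalEquality using (_≡_)

Graph : ℕ → Set
Graph n = Fin (suc n) → Fin (suc n) → Bool

-- Adjacency in the graph built by a construction sequence: vertices are
-- added in the order 0,1,…,n (construction positions); the vertex added at
-- position p is dominating if s p ≡ true and isolated otherwise (s 0 is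
-- irrelevant).
constrAdj : ∀ {n} → (Fin (suc n) → Bool) → Fin (suc n) → Fin (suc n) → Bool
constrAdj s p r =
  if toℕ p <ᵇ toℕ r then s r else (if toℕ r <ᵇ toℕ p then s p else false)

-- G is a threshold graph: it is (isomorphic to) the graph obtained from a
-- construction sequence, via a bijection π from the labels to construction
-- positions.
IsThreshold : ∀ {n} → Graph n → Set
IsThreshold {n} G =
  Σ (Fin (suc n) ↔ Fin (suc n)) λ π →
  Σ (Fin (suc n) → Bool) λ s →
    ∀ i j → G i j ≡ constrAdj s (Inverse.to π i) (Inverse.to π j)

countᵇ : ∀ {A : Set} → (A → Bool) → List A → ℕ
countᵇ p xs = length (filterᵇ p xs)

deg : ∀ {n} → Graph n → Fin (suc n) → ℕ
deg {n} G i = countᵇ (G i) (allFin (suc n))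

dbar : ∀ {n} → Graph n → Fin (suc n) → ℕ
dbar {n} G i = countᵇ (λ j → (toℕ j <ᵇ toℕ i) ∧ G i j) (allFin (suc n))

ReverseDegreeLabeled : ∀ {n} → Graph n → Set
ReverseDegreeLabeled {n} G =
  ∀ (i j : Fin (suc n)) → toℕ i ℕ.< toℕ j → deg G j ℕ.≤ deg G i

edges : ∀ {n} → Graph n → List (Fin (suc n) × Fin (suc n))
edges {n} G =
  concatMap (λ i → map (λ j → (i , j))
                       (filterᵇ (λ j → (toℕ j <ᵇ toℕ i) ∧ G i j) (allFin (suc n))))
            (allFin (suc n))

sumℕ : List ℕ → ℕ
sumℕ = foldr ℕ._+_ 0

sumℤ : List ℤ → ℤ
sumℤ = foldr ℤ._+_ (+ 0)

prodℤ : List ℤ → ℤ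
prodℤ = foldr ℤ._*_ (+ 1)

box : ℕ → ℕ → List (List ℕ)
box B zero    = [] ∷ []
box B (suc m) = concatMap (λ v → map (λ x → x ∷ v) (upTo (suc B))) (box B m)

-- the vertex weights: vertex 0 gets nothing (handled separately), vertex
-- suc k gets a k  (so a : Fin n → ℕ is (a_1,…,a_n))
aAt : ∀ {n} → (Fin n → ℕ) → Fin (suc n) → ℕ
aAt a zero    = 0
aAt a (suc k) = a k

Flow : ∀ {n} → Graph n → Set
Flow G = List ℕ   -- values on edges G, in the order of `edges G`

labelled : ∀ {n} (G : Graph n) → List ℕ → List ((Fin (suc n) × Fin (suc n)) × ℕ)
labelled G x = zip (edges G) x

finEq : ∀ {m} → Fin m → Fin m → Bool
finEq i j = toℕ i ≡ᵇ toℕ j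

outflow inflow : ∀ {n} (G : Graph n) → List ℕ → Fin (suc n) → ℕ
outflow G x k = sumℕ (map proj₂ (filterᵇ (λ e → finEq (proj₁ (proj₁ e)) k) (labelled G x)))
inflow  G x k = sumℕ (map proj₂ (filterᵇ (λ e → finEq (proj₂ (proj₁ e)) k) (labelled G x)))

isFlowᵇ : ∀ {n} (G : Graph n) → (Fin n → ℕ) → List ℕ → Bool
isFlowᵇ {n} G a x =
  (length x ≡ᵇ length (edges G)) ∧
  ((outflow G x zero ℕ.+ sumℕ (map a (allFin n)) ≡ᵇ inflow G x zero) ∧
   and (map (λ k → outflow G x (suc k) ≡ᵇ inflow G x (suc k) ℕ.+ a k) (allFin n)))

-- all nonnegative integer points of F_G(a).  Every such flow has all edge
-- values ≤ Σ a_i (total flow arriving at the sink 0), so the box with bound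
-- Σ a_i contains them all.
intFlows : ∀ {n} (G : Graph n) → (Fin n → ℕ) → List (List ℕ)
intFlows {n} G a = filterᵇ (isFlowᵇ G a) (box (sumℕ (map a (allFin n))) (length (edges G)))

-- wt_{q,0}(b) = (q^b - 0^b)/(q - 0) = q^{b-1} for b > 0, and 1 for b = 0
wt0 : ℤ → ℕ → ℤ
wt0 q zero    = + 1
wt0 q (suc b) = q ℤ.^ b

-- wt_{q,0}(A) = (-(1-q))^{#{a_ij>0} - n} ∏ wt_{q,0}(a_ij).
-- For a ∈ ℤ_{>0}^n every vertex k ≥ 1 has a positive outgoing edge, so
-- #{a_ij > 0} ≥ n and truncated subtraction is exact.
wtFlow0 : ℕ → ℤ → List ℕ → ℤ
wtFlow0 n q x =
  (- (+ 1 ℤ.- q)) ℤ.^ (countᵇ (λ b → 0 <ᵇ b) x ∸ n) ℤ.* prodℤ (map (wt0 q) x)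

Ehr0 : ∀ {n} (G : Graph n) → (Fin n → ℕ) → ℤ → ℤ
Ehr0 {n} G a q = sumℤ (map (wtFlow0 n q) (intFlows G a))

qint : ℤ → ℕ → ℤ
qint q k = sumℤ (map (q ℤ.^_) (upTo k))

rhs : ∀ {n} (G : Graph n) → (Fin n → ℕ) → ℤ → ℤ
rhs {n} G a q =
  prodℤ (map (λ k → (q ℤ.^ (dbar G (suc k) ℕ.* (a k ∸ 1))) ℤ.* qint q (dbar G (suc k)))
             (allFin n))

-- The lower neighbours of a vertex i of a threshold graph labeled by reverse degree sequence
-- are exactly 0, …, d̄ᵢ − 1, and every such j > 0 is adjacent to all vertices below it, so
-- d̄ⱼ = j: neighbourhoods in a threshold graph are nested, and the labeling orders the nesting
-- by degree.  Call such an edge set a staircase.  If d̄ᵢ < i, the vertex d̄ᵢ is not adjacent to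
-- i, hence no vertex above i is either; this gives d̄ᵢ = min(dᵢ, i).
--
-- For a staircase, induct on the top vertex n.  Its outflows w₀, …, w_{d−1} (d = d̄ₙ) form a
-- weak composition of aₙ, and they raise the demand of vertex j by wⱼ.  By induction the
-- remaining flows contribute ∏_{k<n} q^{d̄ₖ(aₖ − 1)}[d̄ₖ]_q times q^{Σ j wⱼ}, because d̄ⱼ = j
-- on the heads j > 0.  Hence the top vertex contributes
-- Σ_w (q − 1)^{#{j : wⱼ > 0} − 1} ∏_{wⱼ>0} q^{wⱼ − 1} · q^{Σ j wⱼ}, which a recursion on the
-- first part of w evaluates to q^{d(aₙ − 1)}[d]_q.

module Submission where

open import Defs
open import Data.Bool using (Bool; true; false; if_then_else_; _∧_; not; T)
import Data.Bool.Properties as BP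
open import Data.Bool.ListAction using (and)
open import Data.Empty using (⊥-elim)
open import Data.Fin as F using (Fin; toℕ; fromℕ<)
import Data.Fin.Properties as FP
open import Data.Integer as ℤ using (ℤ; +_; -_; 0ℤ; 1ℤ)
import Data.Integer.Properties as ℤP
open import Data.Integer.Tactic.RingSolver using (solve-∀)
open import Data.List
  using (List; []; _∷_; map; filterᵇ; concatMap; upTo; applyUpTo; length; _++_; concat; allFin; tabulate; zip)
import Data.List.Properties as LP
open import Data.List.Membership.Propositional using (_∈_)
open import Data.List.Membership.Propositional.Properties using (∈-allFin)
open import Data.List.Relation.Unary.All as All using (All; []; _∷_)
open import Data.List.Relation.Unary.All.Properties using (++⁺; map⁺; concat⁺; applyUpTo⁺₁)
open import Data.List.Relation.Unary.Any using (here; there)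
open import Data.Nat as ℕ using (ℕ; zero; suc; _∸_; _<ᵇ_; _≡ᵇ_; _⊓_; z≤n; s≤s; _≤_; _<_)
import Data.Nat.Properties as ℕP
import Data.Nat.Tactic.RingSolver as ℕ-Solver
open import Data.Product using (_×_; _,_; proj₁; proj₂)
open import Data.Sum using (_⊎_; inj₁; inj₂)
open import Function using (_∘_; case_of_)
open import Function.Bundles using (Inverse)
open import Relation.Binary.Definitions using (tri<; tri≈; tri>)
open import Relation.Binary.PropositionalEquality
open import Relation.Nullary using (yes; no)
open import Relation.Nullary.Decidable using (T?; dec-true; dec-false)

∑ : {A : Set} → (A → ℤ) → List A → ℤ
∑ f xs = sumℤ (map f xs)

∑-map : ∀ {A B : Set} (f : B → ℤ) (g : A → B) xs → ∑ f (map g xs) ≡ ∑ (λ x → f (g x)) xs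
∑-map f g xs = cong sumℤ (sym (LP.map-∘ xs))

∑-++ : ∀ {A : Set} (f : A → ℤ) xs ys → ∑ f (xs ++ ys) ≡ ∑ f xs ℤ.+ ∑ f ys
∑-++ f [] ys = sym (ℤP.+-identityˡ _)
∑-++ f (x ∷ xs) ys = trans (cong (ℤ._+_ (f x)) (∑-++ f xs ys)) (sym (ℤP.+-assoc (f x) _ _))

∑-concatMap : ∀ {A B : Set} (f : B → ℤ) (g : A → List B) xs →
  ∑ f (concatMap g xs) ≡ ∑ (λ x → ∑ f (g x)) xs
∑-concatMap f g [] = refl
∑-concatMap f g (x ∷ xs) =
  trans (∑-++ f (g x) (concatMap g xs)) (cong (ℤ._+_ (∑ f (g x))) (∑-concatMap f g xs))

∑-cong : ∀ {A : Set} {f g : A → ℤ} → (∀ x → f x ≡ g x) → ∀ xs → ∑ f xs ≡ ∑ g xs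
∑-cong f≗g xs = cong sumℤ (LP.map-cong f≗g xs)

∑-congᴬ : ∀ {A : Set} {f g : A → ℤ} {xs} → All (λ x → f x ≡ g x) xs → ∑ f xs ≡ ∑ g xs
∑-congᴬ [] = refl
∑-congᴬ (e ∷ es) = cong₂ ℤ._+_ e (∑-congᴬ es)

∑-zero : ∀ {A : Set} (xs : List A) → ∑ (λ _ → 0ℤ) xs ≡ 0ℤ
∑-zero [] = refl
∑-zero (x ∷ xs) = trans (ℤP.+-identityˡ _) (∑-zero xs)

∑-+ : ∀ {A : Set} (f g : A → ℤ) xs → ∑ (λ x → f x ℤ.+ g x) xs ≡ ∑ f xs ℤ.+ ∑ g xs
∑-+ f g [] = refl
∑-+ f g (x ∷ xs) rewrite ∑-+ f g xs = interchange (f x) (g x) (∑ f xs) (∑ g xs)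
  where
  interchange : ∀ a b c d → (a ℤ.+ b) ℤ.+ (c ℤ.+ d) ≡ (a ℤ.+ c) ℤ.+ (b ℤ.+ d)
  interchange = solve-∀

∑-*ˡ : ∀ {A : Set} (k : ℤ) (f : A → ℤ) xs → ∑ (λ x → k ℤ.* f x) xs ≡ k ℤ.* ∑ f xs
∑-*ˡ k f [] = sym (ℤP.*-zeroʳ k)
∑-*ˡ k f (x ∷ xs) rewrite ∑-*ˡ k f xs = sym (ℤP.*-distribˡ-+ k (f x) (∑ f xs))

∑-*ʳ : ∀ {A : Set} (k : ℤ) (f : A → ℤ) xs → ∑ (λ x → f x ℤ.* k) xs ≡ ∑ f xs ℤ.* k
∑-*ʳ k f xs = trans (∑-cong (λ x → ℤP.*-comm (f x) k) xs)
                    (trans (∑-*ˡ k f xs) (ℤP.*-comm k (∑ f xs)))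

∑-swap : ∀ {A B : Set} (f : A → B → ℤ) xs ys →
  ∑ (λ x → ∑ (f x) ys) xs ≡ ∑ (λ y → ∑ (λ x → f x y) xs) ys
∑-swap f [] ys = sym (∑-zero ys)
∑-swap f (x ∷ xs) ys rewrite ∑-swap f xs ys = sym (∑-+ (f x) (λ y → ∑ (λ x → f x y) xs) ys)

∑-applyUpTo : ∀ {A : Set} (f : A → ℤ) (h : ℕ → A) n →
  ∑ f (applyUpTo h n) ≡ ∑ (λ i → f (h i)) (upTo n)
∑-applyUpTo f h n = trans (cong (∑ f) (sym (LP.map-upTo h n))) (∑-map f h (upTo n))

∑-if : ∀ {A : Set} (b : Bool) (f : A → ℤ) (k : ℤ) xs →
  ∑ (λ x → if b then f x ℤ.* k else 0ℤ) xs ≡ (if b then ∑ f xs ℤ.* k else 0ℤ)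
∑-if true f k xs = ∑-*ʳ k f xs
∑-if false f k xs = ∑-zero xs

∑-filter : ∀ {A : Set} (p : A → Bool) (f : A → ℤ) xs →
  ∑ f (filterᵇ p xs) ≡ ∑ (λ x → if p x then f x else 0ℤ) xs
∑-filter p f [] = refl
∑-filter p f (x ∷ xs) with p x
... | true = cong (ℤ._+_ (f x)) (∑-filter p f xs)
... | false = trans (∑-filter p f xs) (sym (ℤP.+-identityˡ _))

∑-box-suc : ∀ (f : List ℕ → ℤ) B m →
  ∑ f (box B (suc m)) ≡ ∑ (λ v → ∑ (λ x → f (x ∷ v)) (upTo (suc B))) (box B m)
∑-box-suc f B m =
  trans (∑-concatMap f _ (box B m)) (∑-cong (λ v → ∑-map f (_∷ v) (upTo (suc B))) (box B m))

∑-box-+ : ∀ (f : List ℕ → ℤ) B m₁ m₂ →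
  ∑ f (box B (m₁ ℕ.+ m₂)) ≡ ∑ (λ u → ∑ (λ w → f (u ++ w)) (box B m₂)) (box B m₁)
∑-box-+ f B zero m₂ = sym (ℤP.+-identityʳ _)
∑-box-+ f B (suc m₁) m₂ = begin
  ∑ f (box B (suc (m₁ ℕ.+ m₂)))
    ≡⟨ ∑-box-suc f B (m₁ ℕ.+ m₂) ⟩
  ∑ (λ v → ∑ (λ x → f (x ∷ v)) (upTo (suc B))) (box B (m₁ ℕ.+ m₂))
    ≡⟨ ∑-box-+ (λ v → ∑ (λ x → f (x ∷ v)) (upTo (suc B))) B m₁ m₂ ⟩
  ∑ (λ u → ∑ (λ w → ∑ (λ x → f (x ∷ u ++ w)) (upTo (suc B))) (box B m₂)) (box B m₁)
    ≡⟨ ∑-cong (λ u → ∑-swap (λ w x → f (x ∷ u ++ w)) (box B m₂) (upTo (suc B))) (box B m₁) ⟩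
  ∑ (λ u → ∑ (λ x → ∑ (λ w → f (x ∷ u ++ w)) (box B m₂)) (upTo (suc B))) (box B m₁)
    ≡⟨ ∑-box-suc (λ u → ∑ (λ w → f (u ++ w)) (box B m₂)) B m₁ ⟨
  ∑ (λ u → ∑ (λ w → f (u ++ w)) (box B m₂)) (box B (suc m₁)) ∎
  where open ≡-Reasoning

box-length : ∀ B m → All (λ x → length x ≡ m) (box B m)
box-length B zero = refl ∷ []
box-length B (suc m) =
  concat⁺ (map⁺ (All.map (λ eq → map⁺ (All.universal (λ _ → cong suc eq) (upTo (suc B))))
                        (box-length B m)))

splits : ℕ → List (ℕ × ℕ)
splits zero = (0 , 0) ∷ []
splits (suc a) = (0 , suc a) ∷ map (λ (x , y) → (suc x , y)) (splits a)

compositions : ℕ → ℕ → List (List ℕ)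
compositions zero zero = [] ∷ []
compositions zero (suc a) = []
compositions (suc d) a = concatMap (λ (x , y) → map (x ∷_) (compositions d y)) (splits a)

splits-sum : ∀ a → All (λ (x , y) → x ℕ.+ y ≡ a) (splits a)
splits-sum zero = refl ∷ []
splits-sum (suc a) = refl ∷ map⁺ (All.map (cong suc) (splits-sum a))

compositions-sum : ∀ d a → All (λ w → sumℕ w ≡ a) (compositions d a)
compositions-sum zero zero = refl ∷ []
compositions-sum zero (suc a) = []
compositions-sum (suc d) a =
  concat⁺ (map⁺ (All.map (λ {(x , y)} x+y≡a → map⁺ (All.map (λ Σw≡y → trans (cong (x ℕ.+_) Σw≡y) x+y≡a)
                                                          (compositions-sum d y)))
                         (splits-sum a)))

∑-compositions-suc : ∀ (f : List ℕ → ℤ) d a →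
  ∑ f (compositions (suc d) a) ≡ ∑ (λ (x , y) → ∑ (λ v → f (x ∷ v)) (compositions d y)) (splits a)
∑-compositions-suc f d a =
  trans (∑-concatMap f _ (splits a)) (∑-cong (λ (x , y) → ∑-map f (x ∷_) (compositions d y)) (splits a))

∑-upTo-splits : ∀ {A : Set} (V : List A) (σ : A → ℕ) a B → a ≤ B → (F : ℕ → A → ℤ) →
  ∑ (λ x → ∑ (λ v → if x ℕ.+ σ v ≡ᵇ a then F x v else 0ℤ) V) (upTo (suc B))
  ≡ ∑ (λ (x , y) → ∑ (λ v → if σ v ≡ᵇ y then F x v else 0ℤ) V) (splits a)
∑-upTo-splits V σ zero B a≤B F =
  cong (ℤ._+_ (∑ (λ v → if σ v ≡ᵇ 0 then F 0 v else 0ℤ) V))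
    (trans (∑-applyUpTo (λ x → ∑ (λ v → if x ℕ.+ σ v ≡ᵇ 0 then F x v else 0ℤ) V) suc B)
      (trans (∑-cong (λ _ → ∑-zero V) (upTo B)) (∑-zero (upTo B))))
∑-upTo-splits V σ (suc a) (suc B) (s≤s a≤B) F =
  cong (ℤ._+_ (∑ (λ v → if σ v ≡ᵇ suc a then F 0 v else 0ℤ) V))
    (trans (∑-applyUpTo (λ x → ∑ (λ v → if x ℕ.+ σ v ≡ᵇ suc a then F x v else 0ℤ) V) suc (suc B))
      (trans (∑-upTo-splits V σ a B a≤B (λ x v → F (suc x) v))
        (sym (∑-map (λ (x , y) → ∑ (λ v → if σ v ≡ᵇ y then F x v else 0ℤ) V) _ (splits a)))))

∑-box-sum≡ : ∀ d a B → a ≤ B → (f : List ℕ → ℤ) →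
  ∑ (λ w → if sumℕ w ≡ᵇ a then f w else 0ℤ) (box B d) ≡ ∑ f (compositions d a)
∑-box-sum≡ zero zero B a≤B f = refl
∑-box-sum≡ zero (suc a) B a≤B f = refl
∑-box-sum≡ (suc d) a B a≤B f = begin
  ∑ (λ w → if sumℕ w ≡ᵇ a then f w else 0ℤ) (box B (suc d))
    ≡⟨ ∑-box-suc _ B d ⟩
  ∑ (λ v → ∑ (λ x → if x ℕ.+ sumℕ v ≡ᵇ a then f (x ∷ v) else 0ℤ) (upTo (suc B))) (box B d)
    ≡⟨ ∑-swap (λ v x → if x ℕ.+ sumℕ v ≡ᵇ a then f (x ∷ v) else 0ℤ) (box B d) (upTo (suc B)) ⟩
  ∑ (λ x → ∑ (λ v → if x ℕ.+ sumℕ v ≡ᵇ a then f (x ∷ v) else 0ℤ) (box B d)) (upTo (suc B))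
    ≡⟨ ∑-upTo-splits (box B d) sumℕ a B a≤B (λ x v → f (x ∷ v)) ⟩
  ∑ (λ (x , y) → ∑ (λ v → if sumℕ v ≡ᵇ y then f (x ∷ v) else 0ℤ) (box B d)) (splits a)
    ≡⟨ ∑-congᴬ (All.map (λ {(x , y)} x+y≡a → ∑-box-sum≡ d y B (y≤B x+y≡a) (λ v → f (x ∷ v)))
                       (splits-sum a)) ⟩
  ∑ (λ (x , y) → ∑ (λ v → f (x ∷ v)) (compositions d y)) (splits a)
    ≡⟨ ∑-compositions-suc f d a ⟨
  ∑ f (compositions (suc d) a) ∎
  where
  open ≡-Reasoning
  y≤B : ∀ {x y} → x ℕ.+ y ≡ a → y ≤ B
  y≤B {x} {y} x+y≡a = ℕP.≤-trans (ℕP.≤-trans (ℕP.m≤n+m y x) (ℕP.≤-reflexive x+y≡a)) a≤B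

-- A q-identity for weak compositions

-- c q = q − 1, written as in wtFlow0
c : ℤ → ℤ
c q = - (+ 1 ℤ.- q)

wtProd : ℤ → List ℕ → ℤ
wtProd q x = prodℤ (map (wt0 q) x)

positives : List ℕ → ℕ
positives x = countᵇ (λ b → 0 <ᵇ b) x

moment : ℕ → List ℕ → ℕ
moment s [] = 0
moment s (x ∷ w) = s ℕ.* x ℕ.+ moment (suc s) w

term term⁺ : ℤ → ℕ → List ℕ → ℤ
term q s w = c q ℤ.^ (positives w ∸ 1) ℤ.* wtProd q w ℤ.* q ℤ.^ moment s w
term⁺ q s w = c q ℤ.^ positives w ℤ.* wtProd q w ℤ.* q ℤ.^ moment s w

compSum compSum⁺ : ℤ → ℕ → ℕ → ℕ → ℤ
compSum q s d a = ∑ (term q s) (compositions d a)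
compSum⁺ q s d a = ∑ (term⁺ q s) (compositions d a)

^-+ : ∀ q m n → q ℤ.^ (m ℕ.+ n) ≡ q ℤ.^ m ℤ.* q ℤ.^ n
^-+ = ℤP.^-distribˡ-+-*

qint-suc : ∀ q d → qint q (suc d) ≡ 1ℤ ℤ.+ q ℤ.* qint q d
qint-suc q d = cong (ℤ._+_ 1ℤ) (begin
  ∑ (q ℤ.^_) (applyUpTo suc d)  ≡⟨ ∑-applyUpTo _ suc d ⟩
  ∑ (λ i → q ℤ.* q ℤ.^ i) (upTo d) ≡⟨ ∑-*ˡ q _ (upTo d) ⟩
  q ℤ.* qint q d                  ∎)
  where open ≡-Reasoning

c*qint+1≡^ : ∀ q d → c q ℤ.* qint q d ℤ.+ 1ℤ ≡ q ℤ.^ d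
c*qint+1≡^ q zero = cong (ℤ._+ 1ℤ) (ℤP.*-zeroʳ (c q))
c*qint+1≡^ q (suc d) = begin
  c q ℤ.* qint q (suc d) ℤ.+ 1ℤ          ≡⟨ cong (λ I → c q ℤ.* I ℤ.+ 1ℤ) (qint-suc q d) ⟩
  c q ℤ.* (1ℤ ℤ.+ q ℤ.* qint q d) ℤ.+ 1ℤ ≡⟨ shift q (qint q d) ⟩
  q ℤ.* (c q ℤ.* qint q d ℤ.+ 1ℤ)        ≡⟨ cong (q ℤ.*_) (c*qint+1≡^ q d) ⟩
  q ℤ.* q ℤ.^ d                          ∎
  where
  open ≡-Reasoning
  shift : ∀ q I → (- (+ 1 ℤ.- q)) ℤ.* (1ℤ ℤ.+ q ℤ.* I) ℤ.+ 1ℤ ≡ q ℤ.* ((- (+ 1 ℤ.- q)) ℤ.* I ℤ.+ 1ℤ)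
  shift = solve-∀

term-0∷ : ∀ q s v → term q s (0 ∷ v) ≡ term q (suc s) v
term-0∷ q s v rewrite ℕP.*-zeroʳ s =
  cong (λ z → c q ℤ.^ (positives v ∸ 1) ℤ.* z ℤ.* q ℤ.^ moment (suc s) v) (ℤP.*-identityˡ (wtProd q v))

term⁺-0∷ : ∀ q s v → term⁺ q s (0 ∷ v) ≡ term⁺ q (suc s) v
term⁺-0∷ q s v rewrite ℕP.*-zeroʳ s =
  cong (λ z → c q ℤ.^ positives v ℤ.* z ℤ.* q ℤ.^ moment (suc s) v) (ℤP.*-identityˡ (wtProd q v))

-- A positive leading entry uses up the exponent 1 that term subtracts.
term-suc∷ : ∀ q s x v → term q s (suc x ∷ v) ≡ q ℤ.^ (x ℕ.+ s ℕ.* suc x) ℤ.* term⁺ q (suc s) v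
term-suc∷ q s x v rewrite ^-+ q x (s ℕ.* suc x) | ^-+ q (s ℕ.* suc x) (moment (suc s) v) =
  regroup (c q ℤ.^ positives v) (q ℤ.^ x) (wtProd q v) (q ℤ.^ (s ℕ.* suc x)) (q ℤ.^ moment (suc s) v)
  where
  regroup : ∀ C X P Y Z → C ℤ.* (X ℤ.* P) ℤ.* (Y ℤ.* Z) ≡ X ℤ.* Y ℤ.* (C ℤ.* P ℤ.* Z)
  regroup = solve-∀

compSum⁺-0 : ∀ q s d → compSum⁺ q s d 0 ≡ 1ℤ
compSum⁺-0 q s zero = refl
compSum⁺-0 q s (suc d) = begin
  ∑ (term⁺ q s) (map (0 ∷_) (compositions d 0) ++ [])
    ≡⟨ cong (∑ (term⁺ q s)) (LP.++-identityʳ (map (0 ∷_) (compositions d 0))) ⟩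
  ∑ (term⁺ q s) (map (0 ∷_) (compositions d 0))
    ≡⟨ ∑-map (term⁺ q s) (0 ∷_) (compositions d 0) ⟩
  ∑ (λ v → term⁺ q s (0 ∷ v)) (compositions d 0)
    ≡⟨ ∑-cong (term⁺-0∷ q s) (compositions d 0) ⟩
  compSum⁺ q (suc s) d 0
    ≡⟨ compSum⁺-0 q (suc s) d ⟩
  1ℤ ∎
  where open ≡-Reasoning

positives-suc : ∀ w {a} → sumℕ w ≡ suc a → positives w ≡ suc (positives w ∸ 1)
positives-suc (zero ∷ w) eq = positives-suc w eq
positives-suc (suc x ∷ w) eq = refl

compSum⁺≡c*compSum : ∀ q s d a → compSum⁺ q s d (suc a) ≡ c q ℤ.* compSum q s d (suc a)
compSum⁺≡c*compSum q s d a =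
  trans (∑-congᴬ (All.map (λ {w} → termwise w) (compositions-sum d (suc a))))
        (∑-*ˡ (c q) (term q s) (compositions d (suc a)))
  where
  termwise : ∀ w → sumℕ w ≡ suc a → term⁺ q s w ≡ c q ℤ.* term q s w
  termwise w eq rewrite positives-suc w eq =
    regroup (c q) (c q ℤ.^ (positives w ∸ 1)) (wtProd q w) (q ℤ.^ moment s w)
    where
    regroup : ∀ k C P Z → k ℤ.* C ℤ.* P ℤ.* Z ≡ k ℤ.* (C ℤ.* P ℤ.* Z)
    regroup = solve-∀

headSum : ℤ → ℕ → ℕ → ℕ → ℤ
headSum q s d a = ∑ (λ (x , y) → q ℤ.^ (x ℕ.+ s ℕ.* suc x) ℤ.* compSum⁺ q (suc s) d y) (splits a)

compSum-suc : ∀ q s d a →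
  compSum q s (suc d) (suc a) ≡ compSum q (suc s) d (suc a) ℤ.+ headSum q s d a
compSum-suc q s d a = begin
  ∑ (term q s) (map (0 ∷_) (compositions d (suc a)) ++ concatMap g (map sh (splits a)))
    ≡⟨ ∑-++ (term q s) (map (0 ∷_) (compositions d (suc a))) _ ⟩
  ∑ (term q s) (map (0 ∷_) (compositions d (suc a))) ℤ.+ ∑ (term q s) (concatMap g (map sh (splits a)))
    ≡⟨ cong₂ ℤ._+_ zeroHead positiveHead ⟩
  compSum q (suc s) d (suc a) ℤ.+ headSum q s d a ∎
  where
  open ≡-Reasoning
  g : ℕ × ℕ → List (List ℕ)
  g (x , y) = map (x ∷_) (compositions d y)
  sh : ℕ × ℕ → ℕ × ℕ
  sh (x , y) = (suc x , y)
  zeroHead : ∑ (term q s) (map (0 ∷_) (compositions d (suc a))) ≡ compSum q (suc s) d (suc a)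
  zeroHead = trans (∑-map (term q s) (0 ∷_) (compositions d (suc a)))
                   (∑-cong (term-0∷ q s) (compositions d (suc a)))
  positiveHead : ∑ (term q s) (concatMap g (map sh (splits a))) ≡ headSum q s d a
  positiveHead = begin
    ∑ (term q s) (concatMap g (map sh (splits a)))
      ≡⟨ ∑-concatMap (term q s) g (map sh (splits a)) ⟩
    ∑ (λ p → ∑ (term q s) (g p)) (map sh (splits a))
      ≡⟨ ∑-map (λ p → ∑ (term q s) (g p)) sh (splits a) ⟩
    ∑ (λ (x , y) → ∑ (term q s) (map (suc x ∷_) (compositions d y))) (splits a)
      ≡⟨ ∑-cong (λ (x , y) → trans (∑-map (term q s) (suc x ∷_) (compositions d y))
                              (trans (∑-cong (term-suc∷ q s x) (compositions d y))
                                     (∑-*ˡ (q ℤ.^ (x ℕ.+ s ℕ.* suc x)) (term⁺ q (suc s)) (compositions d y))))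
                (splits a) ⟩
    headSum q s d a ∎

headSum-suc : ∀ q s d a →
  headSum q s d (suc a) ≡ q ℤ.^ s ℤ.* compSum⁺ q (suc s) d (suc a) ℤ.+ q ℤ.^ suc s ℤ.* headSum q s d a
headSum-suc q s d a =
  cong₂ ℤ._+_ (cong (λ e → q ℤ.^ e ℤ.* compSum⁺ q (suc s) d (suc a)) (ℕP.*-identityʳ s))
              (trans (∑-map F (λ (x , y) → (suc x , y)) (splits a))
                     (trans (∑-cong shifted (splits a)) (∑-*ˡ (q ℤ.^ suc s) F (splits a))))
  where
  F : ℕ × ℕ → ℤ
  F (x , y) = q ℤ.^ (x ℕ.+ s ℕ.* suc x) ℤ.* compSum⁺ q (suc s) d y
  exponent : ∀ s x → suc x ℕ.+ s ℕ.* suc (suc x) ≡ suc s ℕ.+ (x ℕ.+ s ℕ.* suc x)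
  exponent = ℕ-Solver.solve-∀
  shifted : ∀ p → F (suc (proj₁ p) , proj₂ p) ≡ q ℤ.^ suc s ℤ.* F p
  shifted (x , y) = trans (cong (λ e → q ℤ.^ e ℤ.* compSum⁺ q (suc s) d y) (exponent s x))
                     (trans (cong (ℤ._* compSum⁺ q (suc s) d y) (^-+ q (suc s) (x ℕ.+ s ℕ.* suc x)))
                            (ℤP.*-assoc (q ℤ.^ suc s) (q ℤ.^ (x ℕ.+ s ℕ.* suc x)) (compSum⁺ q (suc s) d y)))

headSum-closed : ∀ q s d → (∀ a → compSum q (suc s) d (suc a) ≡ q ℤ.^ ((suc s ℕ.+ d) ℕ.* a ℕ.+ suc s) ℤ.* qint q d) →
  ∀ a → headSum q s d a ≡ q ℤ.^ (suc (s ℕ.+ d) ℕ.* a ℕ.+ s)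
headSum-closed q s d IH zero
  rewrite compSum⁺-0 q (suc s) d | ℕP.*-identityʳ s | ℕP.*-zeroʳ (s ℕ.+ d) =
  trans (ℤP.+-identityʳ _) (ℤP.*-identityʳ _)
headSum-closed q s d IH (suc a) = begin
  headSum q s d (suc a)
    ≡⟨ headSum-suc q s d a ⟩
  Y ℤ.* compSum⁺ q (suc s) d (suc a) ℤ.+ q ℤ.^ suc s ℤ.* headSum q s d a
    ≡⟨ cong₂ (λ u v → Y ℤ.* u ℤ.+ q ℤ.^ suc s ℤ.* v)
             (trans (compSum⁺≡c*compSum q (suc s) d a) (cong (c q ℤ.*_) (IH a)))
             (headSum-closed q s d IH a) ⟩
  Y ℤ.* (c q ℤ.* (q ℤ.^ (e ℕ.+ suc s) ℤ.* qint q d)) ℤ.+ q ℤ.* Y ℤ.* q ℤ.^ (e ℕ.+ s)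
    ≡⟨ cong₂ (λ u v → Y ℤ.* (c q ℤ.* (u ℤ.* qint q d)) ℤ.+ q ℤ.* Y ℤ.* v) (^-+ q e (suc s)) (^-+ q e s) ⟩
  Y ℤ.* (c q ℤ.* (X ℤ.* (q ℤ.* Y) ℤ.* qint q d)) ℤ.+ q ℤ.* Y ℤ.* (X ℤ.* Y)
    ≡⟨ factor Y (c q) X q (qint q d) ⟩
  X ℤ.* ((c q ℤ.* qint q d ℤ.+ 1ℤ) ℤ.* (Y ℤ.* (q ℤ.* Y)))
    ≡⟨ cong (λ z → X ℤ.* (z ℤ.* (Y ℤ.* (q ℤ.* Y)))) (c*qint+1≡^ q d) ⟩
  X ℤ.* (q ℤ.^ d ℤ.* (q ℤ.^ s ℤ.* q ℤ.^ suc s))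
    ≡⟨ cong (X ℤ.*_) (trans (^-+ q d (s ℕ.+ suc s)) (cong (q ℤ.^ d ℤ.*_) (^-+ q s (suc s)))) ⟨
  X ℤ.* q ℤ.^ (d ℕ.+ (s ℕ.+ suc s))
    ≡⟨ ^-+ q e (d ℕ.+ (s ℕ.+ suc s)) ⟨
  q ℤ.^ (e ℕ.+ (d ℕ.+ (s ℕ.+ suc s)))
    ≡⟨ cong (q ℤ.^_) (exponent s d a) ⟩
  q ℤ.^ (suc (s ℕ.+ d) ℕ.* suc a ℕ.+ s) ∎
  where
  open ≡-Reasoning
  e = suc (s ℕ.+ d) ℕ.* a
  X = q ℤ.^ e
  Y = q ℤ.^ s
  factor : ∀ Y C X q I → Y ℤ.* (C ℤ.* (X ℤ.* (q ℤ.* Y) ℤ.* I)) ℤ.+ q ℤ.* Y ℤ.* (X ℤ.* Y)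
                         ≡ X ℤ.* ((C ℤ.* I ℤ.+ 1ℤ) ℤ.* (Y ℤ.* (q ℤ.* Y)))
  factor = solve-∀
  exponent : ∀ s d a → suc (s ℕ.+ d) ℕ.* a ℕ.+ (d ℕ.+ (s ℕ.+ suc s)) ≡ suc (s ℕ.+ d) ℕ.* suc a ℕ.+ s
  exponent = ℕ-Solver.solve-∀

compSum-closed : ∀ q d s a → compSum q s d (suc a) ≡ q ℤ.^ ((s ℕ.+ d) ℕ.* a ℕ.+ s) ℤ.* qint q d
compSum-closed q zero s a = sym (ℤP.*-zeroʳ (q ℤ.^ ((s ℕ.+ 0) ℕ.* a ℕ.+ s)))
compSum-closed q (suc d) s a = begin
  compSum q s (suc d) (suc a)
    ≡⟨ compSum-suc q s d a ⟩
  compSum q (suc s) d (suc a) ℤ.+ headSum q s d a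
    ≡⟨ cong₂ ℤ._+_ (compSum-closed q d (suc s) a) (headSum-closed q s d (compSum-closed q d (suc s)) a) ⟩
  q ℤ.^ (e ℕ.+ suc s) ℤ.* qint q d ℤ.+ q ℤ.^ (e ℕ.+ s)
    ≡⟨ cong₂ (λ u v → u ℤ.* qint q d ℤ.+ v) (^-+ q e (suc s)) (^-+ q e s) ⟩
  X ℤ.* (q ℤ.* Y) ℤ.* qint q d ℤ.+ X ℤ.* Y
    ≡⟨ factor X Y q (qint q d) ⟩
  X ℤ.* Y ℤ.* (1ℤ ℤ.+ q ℤ.* qint q d)
    ≡⟨ cong₂ ℤ._*_ (^-+ q e s) (qint-suc q d) ⟨
  q ℤ.^ (e ℕ.+ s) ℤ.* qint q (suc d)
    ≡⟨ cong (λ z → q ℤ.^ (z ℕ.* a ℕ.+ s) ℤ.* qint q (suc d)) (ℕP.+-suc s d) ⟨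
  q ℤ.^ ((s ℕ.+ suc d) ℕ.* a ℕ.+ s) ℤ.* qint q (suc d) ∎
  where
  open ≡-Reasoning
  e = suc (s ℕ.+ d) ℕ.* a
  X = q ℤ.^ e
  Y = q ℤ.^ s
  factor : ∀ X Y q I → X ℤ.* (q ℤ.* Y) ℤ.* I ℤ.+ X ℤ.* Y ≡ X ℤ.* Y ℤ.* (1ℤ ℤ.+ q ℤ.* I)
  factor = solve-∀

≡ᵇ-true : ∀ {m n} → m ≡ n → (m ≡ᵇ n) ≡ true
≡ᵇ-true {m} {n} = dec-true (m ℕP.≟ n)

≡ᵇ-false : ∀ {m n} → m ≢ n → (m ≡ᵇ n) ≡ false
≡ᵇ-false {m} {n} = dec-false (m ℕP.≟ n)

∧-true-l : ∀ {a b} → (a ∧ b) ≡ true → a ≡ true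
∧-true-l {true} _ = refl

∧-true-r : ∀ {a b} → (a ∧ b) ≡ true → b ≡ true
∧-true-r {true} e = e

+-cancelˡ-≡ᵇ : ∀ k m n → (k ℕ.+ m ≡ᵇ k ℕ.+ n) ≡ (m ≡ᵇ n)
+-cancelˡ-≡ᵇ zero m n = refl
+-cancelˡ-≡ᵇ (suc k) m n = +-cancelˡ-≡ᵇ k m n

<ᵇ-true : ∀ {m n} → m < n → (m <ᵇ n) ≡ true
<ᵇ-true {m} {n} = dec-true (m ℕP.<? n)

<ᵇ-false : ∀ {m n} → n ≤ m → (m <ᵇ n) ≡ false
<ᵇ-false {m} {n} n≤m = dec-false (m ℕP.<? n) (ℕP.≤⇒≯ n≤m)

-- Iterated operations over k = 1, …, n (vertex 0 is the sink and is never included).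
sumTo : ℕ → (ℕ → ℕ) → ℕ
sumTo zero f = 0
sumTo (suc n) f = sumTo n f ℕ.+ f (suc n)

andTo : ℕ → (ℕ → Bool) → Bool
andTo zero f = true
andTo (suc n) f = andTo n f ∧ f (suc n)

prodTo : ℕ → (ℕ → ℤ) → ℤ
prodTo zero f = 1ℤ
prodTo (suc n) f = prodTo n f ℤ.* f (suc n)

InRange : ℕ → ℕ → Set
InRange n k = 0 < k × k ≤ n

InRange-suc : ∀ {n k} → InRange n k → InRange (suc n) k
InRange-suc (0<k , k≤n) = 0<k , ℕP.m≤n⇒m≤1+n k≤n

sumTo-cong : ∀ n {f g : ℕ → ℕ} → (∀ {k} → InRange n k → f k ≡ g k) → sumTo n f ≡ sumTo n g
sumTo-cong zero f≗g = refl
sumTo-cong (suc n) f≗g = cong₂ ℕ._+_ (sumTo-cong n (f≗g ∘ InRange-suc)) (f≗g (s≤s z≤n , ℕP.≤-refl))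

andTo-cong : ∀ n {f g : ℕ → Bool} → (∀ {k} → InRange n k → f k ≡ g k) → andTo n f ≡ andTo n g
andTo-cong zero f≗g = refl
andTo-cong (suc n) f≗g = cong₂ _∧_ (andTo-cong n (f≗g ∘ InRange-suc)) (f≗g (s≤s z≤n , ℕP.≤-refl))

prodTo-cong : ∀ n {f g : ℕ → ℤ} → (∀ {k} → InRange n k → f k ≡ g k) → prodTo n f ≡ prodTo n g
prodTo-cong zero f≗g = refl
prodTo-cong (suc n) f≗g = cong₂ ℤ._*_ (prodTo-cong n (f≗g ∘ InRange-suc)) (f≗g (s≤s z≤n , ℕP.≤-refl))

sumTo-+ : ∀ n (f g : ℕ → ℕ) → sumTo n (λ k → f k ℕ.+ g k) ≡ sumTo n f ℕ.+ sumTo n g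
sumTo-+ zero f g = refl
sumTo-+ (suc n) f g rewrite sumTo-+ n f g = interchange (sumTo n f) (sumTo n g) (f (suc n)) (g (suc n))
  where
  interchange : ∀ a b c d → a ℕ.+ b ℕ.+ (c ℕ.+ d) ≡ a ℕ.+ c ℕ.+ (b ℕ.+ d)
  interchange = ℕ-Solver.solve-∀

sumTo-zero : ∀ n → sumTo n (λ _ → 0) ≡ 0
sumTo-zero zero = refl
sumTo-zero (suc n) = trans (ℕP.+-identityʳ _) (sumTo-zero n)

prodTo-* : ∀ n (f g : ℕ → ℤ) → prodTo n (λ k → f k ℤ.* g k) ≡ prodTo n f ℤ.* prodTo n g
prodTo-* zero f g = refl
prodTo-* (suc n) f g rewrite prodTo-* n f g = interchange (prodTo n f) (prodTo n g) (f (suc n)) (g (suc n))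
  where
  interchange : ∀ a b c d → a ℤ.* b ℤ.* (c ℤ.* d) ≡ a ℤ.* c ℤ.* (b ℤ.* d)
  interchange = solve-∀

prodTo-^ : ∀ q n (f : ℕ → ℕ) → prodTo n (λ k → q ℤ.^ f k) ≡ q ℤ.^ sumTo n f
prodTo-^ q zero f = refl
prodTo-^ q (suc n) f rewrite prodTo-^ q n f = sym (^-+ q (sumTo n f) (f (suc n)))

sumTo-indicator-0 : ∀ n (f : ℕ → ℕ) → sumTo n (λ k → if 0 ≡ᵇ k then f k else 0) ≡ 0
sumTo-indicator-0 zero f = refl
sumTo-indicator-0 (suc n) f = trans (ℕP.+-identityʳ _) (sumTo-indicator-0 n f)

sumTo-indicator-> : ∀ n j (f : ℕ → ℕ) → n < j → sumTo n (λ k → if j ≡ᵇ k then f k else 0) ≡ 0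
sumTo-indicator-> zero j f n<j = refl
sumTo-indicator-> (suc n) j f n<j rewrite ≡ᵇ-false {j} {suc n} (λ e → ℕP.<-irrefl (sym e) n<j) =
  trans (ℕP.+-identityʳ _) (sumTo-indicator-> n j f (ℕP.<-trans (ℕP.n<1+n n) n<j))

sumTo-indicator : ∀ n j (f : ℕ → ℕ) → suc j ≤ n → sumTo n (λ k → if suc j ≡ᵇ k then f k else 0) ≡ f (suc j)
sumTo-indicator (suc n) j f (s≤s j≤n) with ℕP.m≤n⇒m<n∨m≡n j≤n
... | inj₁ j<n rewrite ≡ᵇ-false {j} {n} (λ e → ℕP.<-irrefl e j<n) =
  trans (ℕP.+-identityʳ _) (sumTo-indicator n j f j<n)
... | inj₂ refl rewrite ≡ᵇ-true {j} refl =
  cong (ℕ._+ f (suc j)) (sumTo-indicator-> j (suc j) f (ℕP.n<1+n j))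

indicator-total : ∀ n j v → j ≤ n → (if j ≡ᵇ 0 then v else 0) ℕ.+ sumTo n (λ k → if j ≡ᵇ k then v else 0) ≡ v
indicator-total n zero v _ = trans (cong (v ℕ.+_) (sumTo-indicator-0 n (λ _ → v))) (ℕP.+-identityʳ v)
indicator-total n (suc j) v j≤n = sumTo-indicator n j (λ _ → v) j≤n

-- Flows on lists of edges (tail , head) between natural numbers

outflowᴺ inflowᴺ : List (ℕ × ℕ) → List ℕ → ℕ → ℕ
outflowᴺ [] _ k = 0
outflowᴺ (_ ∷ _) [] k = 0
outflowᴺ ((i , j) ∷ es) (v ∷ x) k = (if i ≡ᵇ k then v else 0) ℕ.+ outflowᴺ es x k
inflowᴺ [] _ k = 0
inflowᴺ (_ ∷ _) [] k = 0
inflowᴺ ((i , j) ∷ es) (v ∷ x) k = (if j ≡ᵇ k then v else 0) ℕ.+ inflowᴺ es x k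

headMoment : List (ℕ × ℕ) → List ℕ → ℕ
headMoment [] _ = 0
headMoment (_ ∷ _) [] = 0
headMoment ((i , j) ∷ es) (v ∷ x) = j ℕ.* v ℕ.+ headMoment es x

outflowᴺ-++ : ∀ es gs u w k → length u ≡ length es →
  outflowᴺ (es ++ gs) (u ++ w) k ≡ outflowᴺ es u k ℕ.+ outflowᴺ gs w k
outflowᴺ-++ [] gs [] w k _ = refl
outflowᴺ-++ ((i , j) ∷ es) gs (v ∷ u) w k eq rewrite outflowᴺ-++ es gs u w k (ℕP.suc-injective eq) =
  sym (ℕP.+-assoc (if i ≡ᵇ k then v else 0) _ _)

inflowᴺ-++ : ∀ es gs u w k → length u ≡ length es →
  inflowᴺ (es ++ gs) (u ++ w) k ≡ inflowᴺ es u k ℕ.+ inflowᴺ gs w k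
inflowᴺ-++ [] gs [] w k _ = refl
inflowᴺ-++ ((i , j) ∷ es) gs (v ∷ u) w k eq rewrite inflowᴺ-++ es gs u w k (ℕP.suc-injective eq) =
  sym (ℕP.+-assoc (if j ≡ᵇ k then v else 0) _ _)

outflowᴺ-none : ∀ es x k → All (λ (i , _) → i ≢ k) es → outflowᴺ es x k ≡ 0
outflowᴺ-none [] x k _ = refl
outflowᴺ-none (_ ∷ _) [] k _ = refl
outflowᴺ-none ((i , j) ∷ es) (v ∷ x) k (i≢k ∷ rest) rewrite ≡ᵇ-false i≢k = outflowᴺ-none es x k rest

inflowᴺ-none : ∀ es x k → All (λ (_ , j) → j ≢ k) es → inflowᴺ es x k ≡ 0
inflowᴺ-none [] x k _ = refl
inflowᴺ-none (_ ∷ _) [] k _ = refl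
inflowᴺ-none ((i , j) ∷ es) (v ∷ x) k (j≢k ∷ rest) rewrite ≡ᵇ-false j≢k = inflowᴺ-none es x k rest

outflowᴺ-all : ∀ es x k → All (λ (i , _) → i ≡ k) es → length x ≡ length es → outflowᴺ es x k ≡ sumℕ x
outflowᴺ-all [] [] k _ _ = refl
outflowᴺ-all ((i , j) ∷ es) (v ∷ x) k (i≡k ∷ rest) eq rewrite ≡ᵇ-true i≡k =
  cong (v ℕ.+_) (outflowᴺ-all es x k rest (ℕP.suc-injective eq))

-- Every unit of flow enters exactly one vertex among 0, …, n.
inflowᴺ-total : ∀ n es x → All (λ (_ , j) → j ≤ n) es → length x ≡ length es →
  inflowᴺ es x 0 ℕ.+ sumTo n (inflowᴺ es x) ≡ sumℕ x
inflowᴺ-total n [] [] _ _ = sumTo-zero n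
inflowᴺ-total n ((i , j) ∷ es) (v ∷ x) (j≤n ∷ rest) eq = begin
  (at 0 ℕ.+ inflowᴺ es x 0) ℕ.+ sumTo n (λ k → at k ℕ.+ inflowᴺ es x k)
    ≡⟨ cong ((at 0 ℕ.+ inflowᴺ es x 0) ℕ.+_) (sumTo-+ n at (inflowᴺ es x)) ⟩
  (at 0 ℕ.+ inflowᴺ es x 0) ℕ.+ (sumTo n at ℕ.+ sumTo n (inflowᴺ es x))
    ≡⟨ interchange (at 0) (inflowᴺ es x 0) (sumTo n at) (sumTo n (inflowᴺ es x)) ⟩
  (at 0 ℕ.+ sumTo n at) ℕ.+ (inflowᴺ es x 0 ℕ.+ sumTo n (inflowᴺ es x))
    ≡⟨ cong₂ ℕ._+_ (indicator-total n j v j≤n) (inflowᴺ-total n es x rest (ℕP.suc-injective eq)) ⟩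
  v ℕ.+ sumℕ x ∎
  where
  open ≡-Reasoning
  at : ℕ → ℕ
  at k = if j ≡ᵇ k then v else 0
  interchange : ∀ a b c d → a ℕ.+ b ℕ.+ (c ℕ.+ d) ≡ a ℕ.+ c ℕ.+ (b ℕ.+ d)
  interchange = ℕ-Solver.solve-∀

sumTo-*inflowᴺ : ∀ (D : ℕ → ℕ) n es x → All (λ (_ , j) → (0 < j → D j ≡ j) × j ≤ n) es →
  sumTo n (λ k → D k ℕ.* inflowᴺ es x k) ≡ headMoment es x
sumTo-*inflowᴺ D n [] x _ = trans (sumTo-cong n (λ {k} _ → ℕP.*-zeroʳ (D k))) (sumTo-zero n)
sumTo-*inflowᴺ D n (_ ∷ _) [] _ = trans (sumTo-cong n (λ {k} _ → ℕP.*-zeroʳ (D k))) (sumTo-zero n)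
sumTo-*inflowᴺ D n ((i , j) ∷ es) (v ∷ x) ((Dj≡j , j≤n) ∷ rest) = begin
  sumTo n (λ k → D k ℕ.* (at k ℕ.+ inflowᴺ es x k))
    ≡⟨ sumTo-cong n (λ {k} _ → ℕP.*-distribˡ-+ (D k) (at k) (inflowᴺ es x k)) ⟩
  sumTo n (λ k → D k ℕ.* at k ℕ.+ D k ℕ.* inflowᴺ es x k)
    ≡⟨ sumTo-+ n _ _ ⟩
  sumTo n (λ k → D k ℕ.* at k) ℕ.+ sumTo n (λ k → D k ℕ.* inflowᴺ es x k)
    ≡⟨ cong₂ ℕ._+_ (trans (sumTo-cong n (λ {k} _ → pull k)) (this j Dj≡j j≤n))
                   (sumTo-*inflowᴺ D n es x rest) ⟩
  j ℕ.* v ℕ.+ headMoment es x ∎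
  where
  open ≡-Reasoning
  at : ℕ → ℕ
  at k = if j ≡ᵇ k then v else 0
  pull : ∀ k → D k ℕ.* at k ≡ (if j ≡ᵇ k then D k ℕ.* v else 0)
  pull k with j ≡ᵇ k
  ... | true = refl
  ... | false = ℕP.*-zeroʳ (D k)
  this : ∀ j → (0 < j → D j ≡ j) → j ≤ n → sumTo n (λ k → if j ≡ᵇ k then D k ℕ.* v else 0) ≡ j ℕ.* v
  this zero _ _ = sumTo-indicator-0 n (λ k → D k ℕ.* v)
  this (suc j) Dj≡j j≤n = trans (sumTo-indicator n j (λ k → D k ℕ.* v) j≤n) (cong (ℕ._* v) (Dj≡j (s≤s z≤n)))

headMoment-star : ∀ N (h : ℕ → ℕ) s w → (∀ j → h j ≡ s ℕ.+ j) →
  headMoment (map (λ j → (N , j)) (applyUpTo h (length w))) w ≡ moment s w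
headMoment-star N h s [] _ = refl
headMoment-star N h s (v ∷ w) h≗s+ =
  cong₂ ℕ._+_ (cong (ℕ._* v) (trans (h≗s+ 0) (ℕP.+-identityʳ s)))
              (headMoment-star N (h ∘ suc) (suc s) w (λ j → trans (h≗s+ (suc j)) (ℕP.+-suc s j)))

positives-++ : ∀ u w → positives (u ++ w) ≡ positives u ℕ.+ positives w
positives-++ [] w = refl
positives-++ (zero ∷ u) w = positives-++ u w
positives-++ (suc x ∷ u) w = cong suc (positives-++ u w)

wtProd-++ : ∀ q u w → wtProd q (u ++ w) ≡ wtProd q u ℤ.* wtProd q w
wtProd-++ q [] w = sym (ℤP.*-identityˡ _)
wtProd-++ q (x ∷ u) w rewrite wtProd-++ q u w = sym (ℤP.*-assoc (wt0 q x) (wtProd q u) (wtProd q w))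

-- The Ehrhart sum of a staircase graph

staircase : (ℕ → ℕ) → ℕ → List (ℕ × ℕ)
staircase D zero = []
staircase D (suc n) = staircase D n ++ map (λ j → (suc n , j)) (upTo (D (suc n)))

record IsStaircase (n : ℕ) (D : ℕ → ℕ) : Set where
  field
    below : ∀ k → D k ≤ k
    full  : ∀ {k j} → k ≤ n → 0 < j → j < D k → D j ≡ j

IsStaircase-pred : ∀ {n D} → IsStaircase (suc n) D → IsStaircase n D
IsStaircase-pred st = record { below = below ; full = λ k≤n → full (ℕP.m≤n⇒m≤1+n k≤n) }
  where open IsStaircase st

isFlowᴺ : ℕ → (ℕ → ℕ) → List (ℕ × ℕ) → List ℕ → Bool
isFlowᴺ n A es x = (outflowᴺ es x 0 ℕ.+ sumTo n A ≡ᵇ inflowᴺ es x 0)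
                 ∧ andTo n (λ k → outflowᴺ es x k ≡ᵇ inflowᴺ es x k ℕ.+ A k)

-- The extra e counts positive entries of edges deleted in the induction below.
flowWt : ℤ → ℕ → ℕ → List ℕ → ℤ
flowWt q n e x = c q ℤ.^ ((positives x ℕ.+ e) ∸ n) ℤ.* wtProd q x

ehrᴺ : ℤ → ℕ → (ℕ → ℕ) → (ℕ → ℕ) → ℕ → ℕ → ℤ
ehrᴺ q n D A e B =
  ∑ (λ x → if isFlowᴺ n A (staircase D n) x then flowWt q n e x else 0ℤ) (box B (length (staircase D n)))

rhsᴺ : ℤ → ℕ → (ℕ → ℕ) → (ℕ → ℕ) → ℤ
rhsᴺ q n D A = prodTo n (λ k → q ℤ.^ (D k ℕ.* (A k ∸ 1)) ℤ.* qint q (D k))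

staircase-edges : ∀ {D} → (∀ k → D k ≤ k) → ∀ n → All (λ (i , j) → j < i × i ≤ n) (staircase D n)
staircase-edges D≤ zero = []
staircase-edges {D} D≤ (suc n) =
  ++⁺ (All.map (λ (j<i , i≤n) → j<i , ℕP.m≤n⇒m≤1+n i≤n) (staircase-edges D≤ n))
      (map⁺ (applyUpTo⁺₁ _ (D (suc n)) (λ j<D → ℕP.<-≤-trans j<D (D≤ (suc n)) , ℕP.≤-refl)))

∑-box-length-++ : ∀ (f : List ℕ → ℤ) B {A : Set} (xs ys : List A) →
  ∑ f (box B (length (xs ++ ys))) ≡ ∑ (λ u → ∑ (λ w → f (u ++ w)) (box B (length ys))) (box B (length xs))
∑-box-length-++ f B xs ys rewrite LP.length-++ xs {ys} = ∑-box-+ f B (length xs) (length ys)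

-- Removing the top vertex suc n: its outflows w on the edges gs are a composition of A (suc n),
-- and they raise the demands of the lower vertices to A' w.
module TopVertex (q : ℤ) (n : ℕ) (D A : ℕ → ℕ)
  (A-pos : ∀ {k} → InRange (suc n) k → 0 < A k) (st : IsStaircase (suc n) D) where

  open IsStaircase st

  d = D (suc n)
  es = staircase D n
  gs : List (ℕ × ℕ)
  gs = map (λ j → (suc n , j)) (upTo d)

  A' : List ℕ → ℕ → ℕ
  A' w k = A k ℕ.+ inflowᴺ gs w k

  gs-length : length gs ≡ d
  gs-length = trans (LP.length-map _ (upTo d)) (LP.length-upTo d)

  gs-edges : All (λ (i , j) → i ≡ suc n × j < d) gs
  gs-edges = map⁺ (applyUpTo⁺₁ _ d (λ j<d → refl , j<d))

  es-out-top : ∀ u → outflowᴺ es u (suc n) ≡ 0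
  es-out-top u = outflowᴺ-none es u (suc n)
    (All.map (λ (_ , i≤n) i≡1+n → ℕP.<-irrefl i≡1+n (s≤s i≤n)) (staircase-edges below n))

  es-in-top : ∀ u → inflowᴺ es u (suc n) ≡ 0
  es-in-top u = inflowᴺ-none es u (suc n)
    (All.map (λ (j<i , i≤n) j≡1+n → ℕP.<-irrefl j≡1+n (s≤s (ℕP.≤-trans (ℕP.<⇒≤ j<i) i≤n)))
             (staircase-edges below n))

  gs-out-lower : ∀ w {k} → k ≤ n → outflowᴺ gs w k ≡ 0
  gs-out-lower w k≤n = outflowᴺ-none gs w _
    (All.map (λ (i≡1+n , _) i≡k → ℕP.<-irrefl (trans (sym i≡k) i≡1+n) (s≤s k≤n)) gs-edges)

  gs-out-top : ∀ w → length w ≡ d → outflowᴺ gs w (suc n) ≡ sumℕ w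
  gs-out-top w |w| = outflowᴺ-all gs w (suc n) (All.map proj₁ gs-edges) (trans |w| (sym gs-length))

  gs-in-top : ∀ w → inflowᴺ gs w (suc n) ≡ 0
  gs-in-top w = inflowᴺ-none gs w (suc n)
    (All.map (λ (_ , j<d) j≡1+n → ℕP.<-irrefl j≡1+n (ℕP.<-≤-trans j<d (below (suc n)))) gs-edges)

  gs-in-total : ∀ w → length w ≡ d → inflowᴺ gs w 0 ℕ.+ sumTo n (inflowᴺ gs w) ≡ sumℕ w
  gs-in-total w |w| = inflowᴺ-total n gs w
    (All.map (λ (_ , j<d) → ℕP.≤-pred (ℕP.<-≤-trans j<d (below (suc n)))) gs-edges) (trans |w| (sym gs-length))

  module _ (u w : List ℕ) (|u| : length u ≡ length es) (|w| : length w ≡ d) where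

    private
      out = λ k → outflowᴺ-++ es gs u w k |u|
      inn = λ k → inflowᴺ-++ es gs u w k |u|

    top-conservation : (outflowᴺ (es ++ gs) (u ++ w) (suc n) ≡ᵇ inflowᴺ (es ++ gs) (u ++ w) (suc n) ℕ.+ A (suc n))
                     ≡ (sumℕ w ≡ᵇ A (suc n))
    top-conservation rewrite out (suc n) | inn (suc n) | es-out-top u | es-in-top u | gs-out-top w |w| | gs-in-top w =
      refl

    lower-conservation : andTo n (λ k → outflowᴺ (es ++ gs) (u ++ w) k ≡ᵇ inflowᴺ (es ++ gs) (u ++ w) k ℕ.+ A k)
                       ≡ andTo n (λ k → outflowᴺ es u k ≡ᵇ inflowᴺ es u k ℕ.+ A' w k)
    lower-conservation = andTo-cong n (λ {k} (_ , k≤n) → cong₂ _≡ᵇ_ (outs k≤n) (ins k))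
      where
      outs : ∀ {k} → k ≤ n → outflowᴺ (es ++ gs) (u ++ w) k ≡ outflowᴺ es u k
      outs {k} k≤n = trans (out k) (trans (cong (outflowᴺ es u k ℕ.+_) (gs-out-lower w k≤n)) (ℕP.+-identityʳ _))
      ins : ∀ k → inflowᴺ (es ++ gs) (u ++ w) k ℕ.+ A k ≡ inflowᴺ es u k ℕ.+ A' w k
      ins k = trans (cong (ℕ._+ A k) (inn k))
                (trans (ℕP.+-assoc (inflowᴺ es u k) _ (A k))
                       (cong (inflowᴺ es u k ℕ.+_) (ℕP.+-comm (inflowᴺ gs w k) (A k))))

    -- The sink balance is unchanged: the new demands A' w account for all of sumℕ w = A (suc n).
    sink-conservation : sumℕ w ≡ A (suc n) →
      (outflowᴺ (es ++ gs) (u ++ w) 0 ℕ.+ sumTo (suc n) A ≡ᵇ inflowᴺ (es ++ gs) (u ++ w) 0)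
      ≡ (outflowᴺ es u 0 ℕ.+ sumTo n (A' w) ≡ᵇ inflowᴺ es u 0)
    sink-conservation Σw≡a = begin
      (outflowᴺ (es ++ gs) (u ++ w) 0 ℕ.+ sumTo (suc n) A ≡ᵇ inflowᴺ (es ++ gs) (u ++ w) 0)
        ≡⟨ cong₂ _≡ᵇ_ (cong₂ ℕ._+_ (trans (out 0) (trans (cong (outflowᴺ es u 0 ℕ.+_) (gs-out-lower w z≤n))
                                                            (ℕP.+-identityʳ _)))
                                    (cong (sumTo n A ℕ.+_) (trans (sym Σw≡a) (sym (gs-in-total w |w|)))))
                      (trans (inn 0) (ℕP.+-comm (inflowᴺ es u 0) g₀)) ⟩
      (outflowᴺ es u 0 ℕ.+ (sumTo n A ℕ.+ (g₀ ℕ.+ G)) ≡ᵇ g₀ ℕ.+ inflowᴺ es u 0)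
        ≡⟨ cong (_≡ᵇ g₀ ℕ.+ inflowᴺ es u 0) (regroup (outflowᴺ es u 0) (sumTo n A) g₀ G) ⟩
      (g₀ ℕ.+ (outflowᴺ es u 0 ℕ.+ (sumTo n A ℕ.+ G)) ≡ᵇ g₀ ℕ.+ inflowᴺ es u 0)
        ≡⟨ +-cancelˡ-≡ᵇ g₀ _ _ ⟩
      (outflowᴺ es u 0 ℕ.+ (sumTo n A ℕ.+ G) ≡ᵇ inflowᴺ es u 0)
        ≡⟨ cong (λ t → outflowᴺ es u 0 ℕ.+ t ≡ᵇ inflowᴺ es u 0) (sumTo-+ n A (inflowᴺ gs w)) ⟨
      (outflowᴺ es u 0 ℕ.+ sumTo n (A' w) ≡ᵇ inflowᴺ es u 0) ∎
      where
      open ≡-Reasoning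
      g₀ = inflowᴺ gs w 0
      G = sumTo n (inflowᴺ gs w)
      regroup : ∀ a b c d → a ℕ.+ (b ℕ.+ (c ℕ.+ d)) ≡ c ℕ.+ (a ℕ.+ (b ℕ.+ d))
      regroup = ℕ-Solver.solve-∀

    isFlowᴺ-split : isFlowᴺ (suc n) A (es ++ gs) (u ++ w)
                  ≡ (if sumℕ w ≡ᵇ A (suc n) then isFlowᴺ n (A' w) es u else false)
    isFlowᴺ-split with sumℕ w ℕP.≟ A (suc n)
    ... | yes Σw≡a rewrite ≡ᵇ-true Σw≡a =
      cong₂ _∧_ (sink-conservation Σw≡a)
                (trans (cong₂ _∧_ lower-conservation (trans top-conservation (≡ᵇ-true Σw≡a))) (BP.∧-identityʳ _))
    ... | no Σw≢a rewrite ≡ᵇ-false Σw≢a =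
      trans (cong (λ b → sink ∧ (lower ∧ b)) (trans top-conservation (≡ᵇ-false Σw≢a)))
            (trans (cong (sink ∧_) (BP.∧-zeroʳ lower)) (BP.∧-zeroʳ sink))
      where
      sink = outflowᴺ (es ++ gs) (u ++ w) 0 ℕ.+ sumTo (suc n) A ≡ᵇ inflowᴺ (es ++ gs) (u ++ w) 0
      lower = andTo n (λ k → outflowᴺ (es ++ gs) (u ++ w) k ≡ᵇ inflowᴺ (es ++ gs) (u ++ w) k ℕ.+ A k)

  a-suc : A (suc n) ≡ suc (A (suc n) ∸ 1)
  a-suc with A (suc n) | A-pos (s≤s z≤n , ℕP.≤-refl)
  ... | suc a | _ = refl

  flowWt-split : ∀ e u w → positives w ≡ suc (positives w ∸ 1) →
    flowWt q (suc n) e (u ++ w) ≡ flowWt q n (positives w ∸ 1 ℕ.+ e) u ℤ.* wtProd q w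
  flowWt-split e u w pos≡ =
    trans (cong₂ ℤ._*_ (cong (c q ℤ.^_) exponent) (wtProd-++ q u w))
          (sym (ℤP.*-assoc (c q ℤ.^ ((positives u ℕ.+ (positives w ∸ 1 ℕ.+ e)) ∸ n)) (wtProd q u) (wtProd q w)))
    where
    regroup : ∀ a k e → a ℕ.+ suc k ℕ.+ e ≡ suc (a ℕ.+ (k ℕ.+ e))
    regroup = ℕ-Solver.solve-∀
    exponent : (positives (u ++ w) ℕ.+ e) ∸ suc n ≡ (positives u ℕ.+ (positives w ∸ 1 ℕ.+ e)) ∸ n
    exponent = cong (_∸ suc n) (trans (cong (ℕ._+ e) (trans (positives-++ u w) (cong (positives u ℕ.+_) pos≡)))
                                      (regroup (positives u) (positives w ∸ 1) e))

  summand-split : ∀ e u w → length u ≡ length es → length w ≡ d →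
    (if isFlowᴺ (suc n) A (es ++ gs) (u ++ w) then flowWt q (suc n) e (u ++ w) else 0ℤ)
    ≡ (if sumℕ w ≡ᵇ A (suc n)
       then (if isFlowᴺ n (A' w) es u then flowWt q n (positives w ∸ 1 ℕ.+ e) u else 0ℤ) ℤ.* wtProd q w
       else 0ℤ)
  summand-split e u w |u| |w| rewrite isFlowᴺ-split u w |u| |w| with sumℕ w ℕP.≟ A (suc n)
  ... | no Σw≢a rewrite ≡ᵇ-false Σw≢a = refl
  ... | yes Σw≡a rewrite ≡ᵇ-true Σw≡a with isFlowᴺ n (A' w) es u
  ...   | true = flowWt-split e u w (positives-suc w (trans Σw≡a a-suc))
  ...   | false = sym (ℤP.*-zeroˡ (wtProd q w))

  ehrᴺ-suc : ∀ e B → ehrᴺ q (suc n) D A e B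
    ≡ ∑ (λ w → if sumℕ w ≡ᵇ A (suc n) then ehrᴺ q n D (A' w) (positives w ∸ 1 ℕ.+ e) B ℤ.* wtProd q w else 0ℤ)
        (box B d)
  ehrᴺ-suc e B = begin
    ∑ F (box B (length (es ++ gs)))
      ≡⟨ ∑-box-length-++ F B es gs ⟩
    ∑ (λ u → ∑ (λ w → F (u ++ w)) (box B (length gs))) (box B (length es))
      ≡⟨ cong (λ m → ∑ (λ u → ∑ (λ w → F (u ++ w)) (box B m)) (box B (length es))) gs-length ⟩
    ∑ (λ u → ∑ (λ w → F (u ++ w)) (box B d)) (box B (length es))
      ≡⟨ ∑-congᴬ (All.map (λ |u| → ∑-congᴬ (All.map (λ |w| → summand-split e _ _ |u| |w|) (box-length B d)))
                          (box-length B (length es))) ⟩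
    ∑ (λ u → ∑ (λ w → H w u) (box B d)) (box B (length es))
      ≡⟨ ∑-swap (λ u w → H w u) (box B (length es)) (box B d) ⟩
    ∑ (λ w → ∑ (λ u → H w u) (box B (length es))) (box B d)
      ≡⟨ ∑-cong (λ w → ∑-if (sumℕ w ≡ᵇ A (suc n)) (lower w) (wtProd q w) (box B (length es))) (box B d) ⟩
    ∑ (λ w → if sumℕ w ≡ᵇ A (suc n) then ehrᴺ q n D (A' w) (positives w ∸ 1 ℕ.+ e) B ℤ.* wtProd q w else 0ℤ)
      (box B d) ∎
    where
    open ≡-Reasoning
    F : List ℕ → ℤ
    F x = if isFlowᴺ (suc n) A (es ++ gs) x then flowWt q (suc n) e x else 0ℤ
    lower : List ℕ → List ℕ → ℤ
    lower w u = if isFlowᴺ n (A' w) es u then flowWt q n (positives w ∸ 1 ℕ.+ e) u else 0ℤ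
    H : List ℕ → List ℕ → ℤ
    H w u = if sumℕ w ≡ᵇ A (suc n) then lower w u ℤ.* wtProd q w else 0ℤ

  -- The raised demands cost exactly q^(Σ j wⱼ), because D j = j at every head j > 0 of gs.
  rhsᴺ-shift : ∀ w → length w ≡ d → rhsᴺ q n D (A' w) ≡ rhsᴺ q n D A ℤ.* q ℤ.^ moment 0 w
  rhsᴺ-shift w |w| = begin
    prodTo n (λ k → q ℤ.^ (D k ℕ.* (A' w k ∸ 1)) ℤ.* qint q (D k))
      ≡⟨ prodTo-cong n (λ k∈ → factor _ (A-pos (InRange-suc k∈))) ⟩
    prodTo n (λ k → (q ℤ.^ (D k ℕ.* (A k ∸ 1)) ℤ.* qint q (D k)) ℤ.* q ℤ.^ (D k ℕ.* inflowᴺ gs w k))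
      ≡⟨ prodTo-* n _ _ ⟩
    rhsᴺ q n D A ℤ.* prodTo n (λ k → q ℤ.^ (D k ℕ.* inflowᴺ gs w k))
      ≡⟨ cong (rhsᴺ q n D A ℤ.*_) (trans (prodTo-^ q n _) (cong (q ℤ.^_) moment≡)) ⟩
    rhsᴺ q n D A ℤ.* q ℤ.^ moment 0 w ∎
    where
    open ≡-Reasoning
    moment≡ : sumTo n (λ k → D k ℕ.* inflowᴺ gs w k) ≡ moment 0 w
    moment≡ = begin
      sumTo n (λ k → D k ℕ.* inflowᴺ gs w k)
        ≡⟨ sumTo-*inflowᴺ D n gs w
             (All.map (λ (_ , j<d) → (λ 0<j → full ℕP.≤-refl 0<j j<d) , ℕP.≤-pred (ℕP.<-≤-trans j<d (below (suc n))))
                      gs-edges) ⟩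
      headMoment gs w
        ≡⟨ cong (λ m → headMoment (map (λ j → (suc n , j)) (upTo m)) w) |w| ⟨
      headMoment (map (λ j → (suc n , j)) (upTo (length w))) w
        ≡⟨ headMoment-star (suc n) (λ j → j) 0 w (λ _ → refl) ⟩
      moment 0 w ∎
    swap : ∀ X Y I → X ℤ.* Y ℤ.* I ≡ X ℤ.* I ℤ.* Y
    swap = solve-∀
    factor : ∀ k → 0 < A k →
      q ℤ.^ (D k ℕ.* (A' w k ∸ 1)) ℤ.* qint q (D k)
      ≡ (q ℤ.^ (D k ℕ.* (A k ∸ 1)) ℤ.* qint q (D k)) ℤ.* q ℤ.^ (D k ℕ.* inflowᴺ gs w k)
    factor k 0<a = trans
      (cong (λ t → q ℤ.^ t ℤ.* qint q (D k))
            (trans (cong (D k ℕ.*_) (ℕP.+-∸-comm (inflowᴺ gs w k) 0<a))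
                   (ℕP.*-distribˡ-+ (D k) (A k ∸ 1) (inflowᴺ gs w k))))
      (trans (cong (ℤ._* qint q (D k)) (^-+ q (D k ℕ.* (A k ∸ 1)) (D k ℕ.* inflowᴺ gs w k)))
             (swap (q ℤ.^ (D k ℕ.* (A k ∸ 1))) (q ℤ.^ (D k ℕ.* inflowᴺ gs w k)) (qint q (D k))))

  A'-pos : ∀ w {k} → InRange n k → 0 < A' w k
  A'-pos w k∈ = ℕP.≤-trans (A-pos (InRange-suc k∈)) (ℕP.m≤m+n _ _)

  A'-bounded : ∀ w B → length w ≡ d → sumℕ w ≡ A (suc n) → sumTo (suc n) A ≤ B → sumTo n (A' w) ≤ B
  A'-bounded w B |w| Σw≡a ΣA≤B = begin
    sumTo n (A' w)                                ≡⟨ sumTo-+ n A (inflowᴺ gs w) ⟩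
    sumTo n A ℕ.+ sumTo n (inflowᴺ gs w)          ≤⟨ ℕP.+-monoʳ-≤ (sumTo n A) (ℕP.m≤n+m _ (inflowᴺ gs w 0)) ⟩
    sumTo n A ℕ.+ (inflowᴺ gs w 0 ℕ.+ sumTo n (inflowᴺ gs w))
                                                  ≡⟨ cong (sumTo n A ℕ.+_) (trans (gs-in-total w |w|) Σw≡a) ⟩
    sumTo (suc n) A                               ≤⟨ ΣA≤B ⟩
    B                                             ∎
    where open ℕP.≤-Reasoning

  ehrᴺ-step : (∀ A″ → (∀ {k} → InRange n k → 0 < A″ k) → ∀ e B → sumTo n A″ ≤ B →
                 ehrᴺ q n D A″ e B ≡ c q ℤ.^ e ℤ.* rhsᴺ q n D A″) →
    ∀ e B → sumTo (suc n) A ≤ B → ehrᴺ q (suc n) D A e B ≡ c q ℤ.^ e ℤ.* rhsᴺ q (suc n) D A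
  ehrᴺ-step IH e B ΣA≤B = begin
    ehrᴺ q (suc n) D A e B
      ≡⟨ ehrᴺ-suc e B ⟩
    ∑ (λ w → if sumℕ w ≡ᵇ A (suc n) then ehrᴺ q n D (A' w) (positives w ∸ 1 ℕ.+ e) B ℤ.* wtProd q w else 0ℤ)
      (box B d)
      ≡⟨ ∑-congᴬ (All.map (λ {w} → summand w) (box-length B d)) ⟩
    ∑ (λ w → K ℤ.* (if sumℕ w ≡ᵇ A (suc n) then term q 0 w else 0ℤ)) (box B d)
      ≡⟨ ∑-*ˡ K _ (box B d) ⟩
    K ℤ.* ∑ (λ w → if sumℕ w ≡ᵇ A (suc n) then term q 0 w else 0ℤ) (box B d)
      ≡⟨ cong (K ℤ.*_) (∑-box-sum≡ d (A (suc n)) B (ℕP.≤-trans (ℕP.m≤n+m _ _) ΣA≤B) (term q 0)) ⟩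
    K ℤ.* compSum q 0 d (A (suc n))
      ≡⟨ cong (λ a → K ℤ.* compSum q 0 d a) a-suc ⟩
    K ℤ.* compSum q 0 d (suc (A (suc n) ∸ 1))
      ≡⟨ cong (K ℤ.*_) (compSum-closed q d 0 (A (suc n) ∸ 1)) ⟩
    K ℤ.* (q ℤ.^ (d ℕ.* (A (suc n) ∸ 1) ℕ.+ 0) ℤ.* qint q d)
      ≡⟨ cong (λ t → K ℤ.* (q ℤ.^ t ℤ.* qint q d)) (ℕP.+-identityʳ (d ℕ.* (A (suc n) ∸ 1))) ⟩
    K ℤ.* (q ℤ.^ (d ℕ.* (A (suc n) ∸ 1)) ℤ.* qint q d)
      ≡⟨ ℤP.*-assoc (c q ℤ.^ e) (rhsᴺ q n D A) _ ⟩
    c q ℤ.^ e ℤ.* rhsᴺ q (suc n) D A ∎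
    where
    open ≡-Reasoning
    K = c q ℤ.^ e ℤ.* rhsᴺ q n D A
    regroup : ∀ Cₖ Cₑ R Q P → Cₖ ℤ.* Cₑ ℤ.* (R ℤ.* Q) ℤ.* P ≡ Cₑ ℤ.* R ℤ.* (Cₖ ℤ.* P ℤ.* Q)
    regroup = solve-∀
    summand : ∀ w → length w ≡ d →
      (if sumℕ w ≡ᵇ A (suc n) then ehrᴺ q n D (A' w) (positives w ∸ 1 ℕ.+ e) B ℤ.* wtProd q w else 0ℤ)
      ≡ K ℤ.* (if sumℕ w ≡ᵇ A (suc n) then term q 0 w else 0ℤ)
    summand w |w| with sumℕ w ℕP.≟ A (suc n)
    ... | no Σw≢a rewrite ≡ᵇ-false Σw≢a = sym (ℤP.*-zeroʳ K)
    ... | yes Σw≡a rewrite ≡ᵇ-true Σw≡a =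
      trans (cong (ℤ._* wtProd q w) (IH (A' w) (A'-pos w) (positives w ∸ 1 ℕ.+ e) B (A'-bounded w B |w| Σw≡a ΣA≤B)))
        (trans (cong₂ (λ x y → x ℤ.* y ℤ.* wtProd q w) (^-+ (c q) (positives w ∸ 1) e) (rhsᴺ-shift w |w|))
               (regroup (c q ℤ.^ (positives w ∸ 1)) (c q ℤ.^ e) (rhsᴺ q n D A) (q ℤ.^ moment 0 w) (wtProd q w)))

ehrᴺ-closed : ∀ q n (D A : ℕ → ℕ) → (∀ {k} → InRange n k → 0 < A k) → IsStaircase n D →
  ∀ e B → sumTo n A ≤ B → ehrᴺ q n D A e B ≡ c q ℤ.^ e ℤ.* rhsᴺ q n D A
ehrᴺ-closed q zero D A A-pos st e B _ = ℤP.+-identityʳ (c q ℤ.^ e ℤ.* 1ℤ)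
ehrᴺ-closed q (suc n) D A A-pos st =
  TopVertex.ehrᴺ-step q n D A A-pos st
    (λ A″ A″-pos → ehrᴺ-closed q n D A″ A″-pos (IsStaircase-pred st))

filterᵇ-map : ∀ {A B : Set} (p : B → Bool) (f : A → B) xs →
  filterᵇ p (map f xs) ≡ map f (filterᵇ (p ∘ f) xs)
filterᵇ-map p f [] = refl
filterᵇ-map p f (x ∷ xs) with p (f x)
... | true = cong (f x ∷_) (filterᵇ-map p f xs)
... | false = filterᵇ-map p f xs

filterᵇ-cong : ∀ {A : Set} {p r : A → Bool} → (∀ x → p x ≡ r x) → ∀ xs → filterᵇ p xs ≡ filterᵇ r xs
filterᵇ-cong h [] = refl
filterᵇ-cong {p = p} {r} h (x ∷ xs) with p x | r x | h x
... | true | true | refl = cong (x ∷_) (filterᵇ-cong h xs)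
... | false | false | refl = filterᵇ-cong h xs

countᵇ-cong : ∀ {A : Set} {p r : A → Bool} → (∀ x → p x ≡ r x) → ∀ xs → countᵇ p xs ≡ countᵇ r xs
countᵇ-cong h xs = cong length (filterᵇ-cong h xs)

countᵇ-map : ∀ {A B : Set} (p : B → Bool) (f : A → B) xs → countᵇ p (map f xs) ≡ countᵇ (p ∘ f) xs
countᵇ-map p f xs = trans (cong length (filterᵇ-map p f xs)) (LP.length-map f (filterᵇ (p ∘ f) xs))

countᵇ-++ : ∀ {A : Set} (p : A → Bool) xs ys → countᵇ p (xs ++ ys) ≡ countᵇ p xs ℕ.+ countᵇ p ys
countᵇ-++ p xs ys = trans (cong length (LP.filter-++ (T? ∘ p) xs ys)) (LP.length-++ (filterᵇ p xs))

countᵇ-≤-length : ∀ {A : Set} (p : A → Bool) xs → countᵇ p xs ≤ length xs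
countᵇ-≤-length p = LP.length-filter (T? ∘ p)

countᵇ-split : ∀ {A : Set} (p r : A → Bool) xs →
  countᵇ p xs ≡ countᵇ (λ x → p x ∧ not (r x)) xs ℕ.+ countᵇ (λ x → p x ∧ r x) xs
countᵇ-split p r [] = refl
countᵇ-split p r (x ∷ xs) with p x | r x
... | true | true = trans (cong suc (countᵇ-split p r xs)) (sym (ℕP.+-suc _ _))
... | true | false = cong suc (countᵇ-split p r xs)
... | false | true = countᵇ-split p r xs
... | false | false = countᵇ-split p r xs

countᵇ-mono : ∀ {A : Set} {p r : A → Bool} → (∀ x → p x ≡ true → r x ≡ true) → ∀ xs → countᵇ p xs ≤ countᵇ r xs
countᵇ-mono h [] = z≤n
countᵇ-mono {p = p} {r} h (x ∷ xs) with p x | r x | h x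
... | true | true | _ = s≤s (countᵇ-mono h xs)
... | true | false | p⇒r = case p⇒r refl of λ ()
... | false | true | _ = ℕP.m≤n⇒m≤1+n (countᵇ-mono h xs)
... | false | false | _ = countᵇ-mono h xs

countᵇ-mono-< : ∀ {A : Set} {p r : A → Bool} → (∀ x → p x ≡ true → r x ≡ true) → ∀ {w} xs → w ∈ xs →
  p w ≡ false → r w ≡ true → countᵇ p xs < countᵇ r xs
countᵇ-mono-< h (x ∷ xs) (here refl) pw rw rewrite pw | rw = s≤s (countᵇ-mono h xs)
countᵇ-mono-< {p = p} {r} h (x ∷ xs) (there w∈) pw rw with p x | r x | h x
... | true | true | _ = s≤s (countᵇ-mono-< h xs w∈ pw rw)
... | true | false | p⇒r = case p⇒r refl of λ ()
... | false | true | _ = ℕP.m≤n⇒m≤1+n (countᵇ-mono-< h xs w∈ pw rw)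
... | false | false | _ = countᵇ-mono-< h xs w∈ pw rw

countᵇ-none : ∀ {A : Set} (p : A → Bool) xs → (∀ x → p x ≡ false) → countᵇ p xs ≡ 0
countᵇ-none p [] h = refl
countᵇ-none p (x ∷ xs) h rewrite h x = countᵇ-none p xs h

countᵇ-all : ∀ {A : Set} (p : A → Bool) xs → All (λ x → p x ≡ true) xs → countᵇ p xs ≡ length xs
countᵇ-all p [] [] = refl
countᵇ-all p (x ∷ xs) (px ∷ pxs) rewrite px = cong suc (countᵇ-all p xs pxs)

finEq-refl : ∀ {N} (x : Fin N) → finEq x x ≡ true
finEq-refl x = ≡ᵇ-true {toℕ x} refl

finEq⇒≡ : ∀ {N} (x y : Fin N) → finEq x y ≡ true → x ≡ y
finEq⇒≡ x y e = FP.toℕ-injective (ℕP.≡ᵇ⇒≡ (toℕ x) (toℕ y) (subst T (sym e) _))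

tabulate-∘toℕ : ∀ {A : Set} N (g : ℕ → A) → tabulate {n = N} (g ∘ toℕ) ≡ applyUpTo g N
tabulate-∘toℕ zero g = refl
tabulate-∘toℕ (suc N) g = cong (g 0 ∷_) (tabulate-∘toℕ N (g ∘ suc))

allFin-suc : ∀ N → allFin (suc N) ≡ F.zero ∷ map F.suc (allFin N)
allFin-suc N = cong (F.zero ∷_) (sym (LP.map-tabulate {n = N} (λ i → i) F.suc))

countᵇ-finEq : ∀ N (v : Fin N) → countᵇ (λ x → finEq x v) (allFin N) ≡ 1
countᵇ-finEq (suc N) F.zero = trans (cong (countᵇ (λ x → finEq x F.zero)) (allFin-suc N))
  (cong suc (trans (countᵇ-map _ F.suc (allFin N)) (countᵇ-none _ (allFin N) (λ _ → refl))))
countᵇ-finEq (suc N) (F.suc v) = trans (cong (countᵇ (λ x → finEq x (F.suc v))) (allFin-suc N))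
  (trans (countᵇ-map _ F.suc (allFin N)) (countᵇ-finEq N v))

DownClosed : (ℕ → Bool) → Set
DownClosed p = ∀ {k k′} → k′ ≤ k → p k ≡ true → p k′ ≡ true

module _ {p : ℕ → Bool} (down : DownClosed p) where

  DownClosed-false : ∀ {N k} → N ≤ k → p N ≡ false → p k ≡ false
  DownClosed-false {N} {k} N≤k pN≡false with p k in pk
  ... | false = refl
  ... | true = trans (sym (down N≤k pk)) pN≡false

  countᵇ-upTo-suc : ∀ N → countᵇ p (upTo (suc N)) ≡ countᵇ p (upTo N) ℕ.+ (if p N then 1 else 0)
  countᵇ-upTo-suc N = trans (cong (countᵇ p) (sym (LP.upTo-∷ʳ N)))
                            (trans (countᵇ-++ p (upTo N) (N ∷ [])) (cong (countᵇ p (upTo N) ℕ.+_) single))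
    where
    single : countᵇ p (N ∷ []) ≡ (if p N then 1 else 0)
    single with p N
    ... | true = refl
    ... | false = refl

  countᵇ-upTo-stable : ∀ N M → N ≤ M → p N ≡ false → countᵇ p (upTo M) ≡ countᵇ p (upTo N)
  countᵇ-upTo-stable N zero z≤n _ = refl
  countᵇ-upTo-stable N (suc M) N≤1+M pN with ℕP.m≤n⇒m<n∨m≡n N≤1+M
  ... | inj₂ refl = refl
  ... | inj₁ (s≤s N≤M) rewrite countᵇ-upTo-suc M | DownClosed-false N≤M pN =
    trans (ℕP.+-identityʳ _) (countᵇ-upTo-stable N M N≤M pN)

  DownClosed⇒initial : ∀ N → p N ≡ false → ∀ k → p k ≡ (k <ᵇ countᵇ p (upTo N))
  DownClosed⇒initial zero pN k = DownClosed-false z≤n pN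
  DownClosed⇒initial (suc N) pN k rewrite countᵇ-upTo-suc N with p N in pN′
  ... | false rewrite ℕP.+-identityʳ (countᵇ p (upTo N)) = DownClosed⇒initial N pN′ k
  ... | true rewrite countᵇ-all p (upTo N) (applyUpTo⁺₁ _ N (λ j<N → down (ℕP.<⇒≤ j<N) pN′))
                   | LP.length-upTo N | ℕP.+-comm N 1 with k ℕP.<? suc N
  ...   | yes k<1+N = trans (down (ℕP.≤-pred k<1+N) pN′) (sym (<ᵇ-true k<1+N))
  ...   | no k≮1+N = trans (DownClosed-false (ℕP.≮⇒≥ k≮1+N) pN) (sym (<ᵇ-false (ℕP.≮⇒≥ k≮1+N)))

-- Threshold graphs labeled by reverse degree sequence

constrAdj-< : ∀ {n} (s : Fin (suc n) → Bool) p y → toℕ p < toℕ y → constrAdj s p y ≡ s y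
constrAdj-< s p y p<y rewrite <ᵇ-true p<y = refl

constrAdj-> : ∀ {n} (s : Fin (suc n) → Bool) p y → toℕ y < toℕ p → constrAdj s p y ≡ s p
constrAdj-> s p y y<p rewrite <ᵇ-false (ℕP.<⇒≤ y<p) | <ᵇ-true y<p = refl

constrAdj-nested : ∀ {n} (s : Fin (suc n) → Bool) (p r y : Fin (suc n)) → toℕ p < toℕ r →
  toℕ y ≢ toℕ p → toℕ y ≢ toℕ r →
  (s r ≡ true → constrAdj s p y ≡ true → constrAdj s r y ≡ true)
  × (s r ≡ false → constrAdj s r y ≡ true → constrAdj s p y ≡ true)
constrAdj-nested s p r y p<r y≢p y≢r with ℕP.<-cmp (toℕ y) (toℕ r)
... | tri≈ _ y≡r _ = ⊥-elim (y≢r y≡r)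
... | tri> _ _ r<y =
  (λ _ py → trans (constrAdj-< s r y r<y) (trans (sym (constrAdj-< s p y (ℕP.<-trans p<r r<y))) py))
  , (λ _ ry → trans (constrAdj-< s p y (ℕP.<-trans p<r r<y)) (trans (sym (constrAdj-< s r y r<y)) ry))
... | tri< y<r _ _ =
  (λ sr _ → trans (constrAdj-> s r y y<r) sr)
  , (λ sr ry → case trans (sym sr) (trans (sym (constrAdj-> s r y y<r)) ry) of λ ())

module ReverseDegreeThreshold (n : ℕ) (G : Graph n)
  (sym-G : ∀ i j → G i j ≡ G j i) (irrefl-G : ∀ i → G i i ≡ false)
  (threshold : IsThreshold G) (labeled : ReverseDegreeLabeled G) where

  private
    π = proj₁ threshold
    s = proj₁ (proj₂ threshold)
    G≡constrAdj = proj₂ (proj₂ threshold)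
    pos = Inverse.to π

    pos-injective : ∀ {x y} → toℕ (pos x) ≡ toℕ (pos y) → x ≡ y
    pos-injective {x} {y} e =
      trans (sym (Inverse.strictlyInverseʳ π x))
            (trans (cong (Inverse.from π) (FP.toℕ-injective e)) (Inverse.strictlyInverseʳ π y))

    pos-≢ : ∀ {x y} → x ≢ y → toℕ (pos x) ≢ toℕ (pos y)
    pos-≢ x≢y e = x≢y (pos-injective e)

    AF = allFin (suc n)

  _≼_ : Fin (suc n) → Fin (suc n) → Set
  u ≼ v = ∀ x → x ≢ u → x ≢ v → G u x ≡ true → G v x ≡ true

  ≼-total : ∀ u v → u ≼ v ⊎ v ≼ u
  ≼-total u v with ℕP.<-cmp (toℕ (pos u)) (toℕ (pos v))
  ... | tri≈ _ e _ = inj₁ (λ x _ _ g → subst (λ z → G z x ≡ true) (pos-injective e) g)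
  ... | tri< lt _ _ with s (pos v) in sv
  ...   | true = inj₁ (λ x x≢u x≢v g →
            trans (G≡constrAdj v x)
              (proj₁ (constrAdj-nested s (pos u) (pos v) (pos x) lt (pos-≢ x≢u) (pos-≢ x≢v)) sv
                     (trans (sym (G≡constrAdj u x)) g)))
  ...   | false = inj₂ (λ x x≢v x≢u g →
            trans (G≡constrAdj u x)
              (proj₂ (constrAdj-nested s (pos u) (pos v) (pos x) lt (pos-≢ x≢u) (pos-≢ x≢v)) sv
                     (trans (sym (G≡constrAdj v x)) g)))
  ≼-total u v | tri> _ _ gt with s (pos u) in su
  ...   | true = inj₂ (λ x x≢v x≢u g →
            trans (G≡constrAdj u x)
              (proj₁ (constrAdj-nested s (pos v) (pos u) (pos x) gt (pos-≢ x≢v) (pos-≢ x≢u)) su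
                     (trans (sym (G≡constrAdj v x)) g)))
  ...   | false = inj₁ (λ x x≢u x≢v g →
            trans (G≡constrAdj v x)
              (proj₂ (constrAdj-nested s (pos v) (pos u) (pos x) gt (pos-≢ x≢v) (pos-≢ x≢u)) su
                     (trans (sym (G≡constrAdj u x)) g)))

  countᵇ-edge : ∀ u v → countᵇ (λ x → G u x ∧ finEq x v) AF ≡ countᵇ (λ x → G v x ∧ finEq x u) AF
  countᵇ-edge u v =
    trans (countᵇ-cong (at v u) AF)
      (trans (indicator (G u v) v)
        (trans (cong (λ b → if b then 1 else 0) (sym-G u v))
          (trans (sym (indicator (G v u) u)) (sym (countᵇ-cong (at u v) AF)))))
    where
    indicator : ∀ b v → countᵇ (λ x → b ∧ finEq x v) AF ≡ (if b then 1 else 0)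
    indicator true v = countᵇ-finEq (suc n) v
    indicator false v = countᵇ-none _ AF (λ _ → refl)
    at : ∀ v u x → (G u x ∧ finEq x v) ≡ (G u v ∧ finEq x v)
    at v u x with finEq x v in e
    ... | true = cong (λ z → G u z ∧ true) (finEq⇒≡ x v e)
    ... | false = trans (BP.∧-zeroʳ _) (sym (BP.∧-zeroʳ _))

  ≼-deg-< : ∀ u v w → u ≼ v → w ≢ u → w ≢ v → G v w ≡ true → G u w ≡ false → deg G u < deg G v
  ≼-deg-< u v w u≼v w≢u w≢v gvw guw =
    subst₂ _<_ (sym (countᵇ-split (G u) (λ x → finEq x v) AF)) (sym (countᵇ-split (G v) (λ x → finEq x u) AF))
      (subst (λ t → off u v ℕ.+ countᵇ (λ x → G u x ∧ finEq x v) AF < off v u ℕ.+ t) (countᵇ-edge u v)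
             (ℕP.+-monoˡ-< (countᵇ (λ x → G u x ∧ finEq x v) AF) off<))
    where
    off : Fin (suc n) → Fin (suc n) → ℕ
    off u v = countᵇ (λ x → G u x ∧ not (finEq x v)) AF
    ≢⇒finEq-false : ∀ {x y} → x ≢ y → finEq x y ≡ false
    ≢⇒finEq-false x≢y = ≡ᵇ-false (λ e → x≢y (FP.toℕ-injective e))
    mono : ∀ x → (G u x ∧ not (finEq x v)) ≡ true → (G v x ∧ not (finEq x u)) ≡ true
    mono x _ with G u x in gux | finEq x v in xv | finEq x u in xu
    ... | true | false | true = case trans (sym (irrefl-G u)) (subst (λ z → G u z ≡ true) (finEq⇒≡ x u xu) gux) of λ ()
    ... | true | false | false
      rewrite u≼v x (λ x≡u → case trans (sym xu) (subst (λ z → finEq x z ≡ true) x≡u (finEq-refl x)) of λ ())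
                    (λ x≡v → case trans (sym xv) (subst (λ z → finEq x z ≡ true) x≡v (finEq-refl x)) of λ ())
                    gux = refl
    off< : off u v < off v u
    off< = countᵇ-mono-< mono AF (∈-allFin w) (cong (_∧ not (finEq w v)) guw)
             (cong₂ (λ a b → a ∧ not b) gvw (≢⇒finEq-false w≢u))

  deg-≤⇒nbhd : ∀ u v w → deg G v ≤ deg G u → G w v ≡ true → w ≢ u → G w u ≡ true
  deg-≤⇒nbhd u v w dv≤du gwv w≢u with ≼-total u v
  ... | inj₂ v≼u = trans (sym-G w u) (v≼u w w≢v w≢u (trans (sym-G v w) gwv))
    where
    w≢v : w ≢ v
    w≢v refl = case trans (sym (irrefl-G v)) gwv of λ ()
  ... | inj₁ u≼v with G w u in gwu
  ...   | true = refl
  ...   | false = ⊥-elim (ℕP.<⇒≱ (≼-deg-< u v w u≼v w≢u w≢v (trans (sym-G v w) gwv) (trans (sym-G u w) gwu)) dv≤du)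
    where
    w≢v : w ≢ v
    w≢v refl = case trans (sym (irrefl-G v)) gwv of λ ()

  nbhd-shift-down : ∀ i j j′ → toℕ j′ < toℕ j → G i j ≡ true → i ≢ j′ → G i j′ ≡ true
  nbhd-shift-down i j j′ j′<j gij i≢j′ = deg-≤⇒nbhd j′ j i (labeled j′ j j′<j) gij i≢j′

  nbhd-above⇒below : ∀ i j k → toℕ j < toℕ i → toℕ i < toℕ k → G i k ≡ true → G i j ≡ true
  nbhd-above⇒below i j k j<i i<k gik =
    deg-≤⇒nbhd j k i (labeled j k (ℕP.<-trans j<i i<k)) gik (λ i≡j → ℕP.<-irrefl (cong toℕ (sym i≡j)) j<i)

  lower-nbhd-full : ∀ i j j′ → toℕ j′ < toℕ j → toℕ j < toℕ i → G i j ≡ true → G j j′ ≡ true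
  lower-nbhd-full i j j′ j′<j j<i gij =
    deg-≤⇒nbhd j′ i j (labeled j′ i (ℕP.<-trans j′<j j<i)) (trans (sym-G j i) gij)
               (λ j≡j′ → ℕP.<-irrefl (cong toℕ (sym j≡j′)) j′<j)

  -- Adjacency to vertex i as a predicate on ℕ (false outside 0, …, n).
  adjᴺ : Fin (suc n) → ℕ → Bool
  adjᴺ i k with k ℕP.<? suc n
  ... | yes k<1+n = G i (fromℕ< k<1+n)
  ... | no _ = false

  adjᴺ-< : ∀ i k (k<1+n : k < suc n) → adjᴺ i k ≡ G i (fromℕ< k<1+n)
  adjᴺ-< i k k<1+n with k ℕP.<? suc n
  ... | yes _ = refl
  ... | no k≮1+n = ⊥-elim (k≮1+n k<1+n)

  adjᴺ-toℕ : ∀ i j → adjᴺ i (toℕ j) ≡ G i j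
  adjᴺ-toℕ i j = trans (adjᴺ-< i (toℕ j) (FP.toℕ<n j)) (cong (G i) (FP.fromℕ<-toℕ j (FP.toℕ<n j)))

  lowerAdjᴺ : Fin (suc n) → ℕ → Bool
  lowerAdjᴺ i k = (k <ᵇ toℕ i) ∧ adjᴺ i k

  lowerAdjᴺ-down : ∀ i → DownClosed (lowerAdjᴺ i)
  lowerAdjᴺ-down i {k} {k′} k′≤k e with ℕP.m≤n⇒m<n∨m≡n k′≤k
  ... | inj₂ refl = e
  ... | inj₁ k′<k =
    cong₂ _∧_ (<ᵇ-true k′<i) (trans (adjᴺ-< i k′ k′<1+n) (nbhd-shift-down i j j′ j′<j gij i≢j′))
    where
    k<i = ℕP.<ᵇ⇒< k (toℕ i) (subst T (sym (∧-true-l e)) _)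
    k<1+n = ℕP.<-trans k<i (FP.toℕ<n i)
    k′<i = ℕP.<-trans k′<k k<i
    k′<1+n = ℕP.<-trans k′<i (FP.toℕ<n i)
    j = fromℕ< k<1+n
    j′ = fromℕ< k′<1+n
    j′<j : toℕ j′ < toℕ j
    j′<j = subst₂ _<_ (sym (FP.toℕ-fromℕ< k′<1+n)) (sym (FP.toℕ-fromℕ< k<1+n)) k′<k
    gij : G i j ≡ true
    gij = trans (sym (adjᴺ-< i k k<1+n)) (∧-true-r e)
    i≢j′ : i ≢ j′
    i≢j′ i≡j′ = ℕP.<-irrefl (trans (sym (FP.toℕ-fromℕ< k′<1+n)) (cong toℕ (sym i≡j′))) k′<i

  lowerAdjᴺ-self : ∀ i → lowerAdjᴺ i (toℕ i) ≡ false
  lowerAdjᴺ-self i rewrite <ᵇ-false (ℕP.≤-refl {toℕ i}) = refl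

  dbar≡countᵇ-upTo : ∀ i → dbar G i ≡ countᵇ (lowerAdjᴺ i) (upTo (toℕ i))
  dbar≡countᵇ-upTo i = begin
    dbar G i
      ≡⟨ countᵇ-cong (λ j → cong ((toℕ j <ᵇ toℕ i) ∧_) (sym (adjᴺ-toℕ i j))) AF ⟩
    countᵇ (lowerAdjᴺ i ∘ toℕ) AF
      ≡⟨ countᵇ-map (lowerAdjᴺ i) toℕ AF ⟨
    countᵇ (lowerAdjᴺ i) (map toℕ AF)
      ≡⟨ cong (countᵇ (lowerAdjᴺ i)) (LP.map-tabulate {n = suc n} (λ j → j) toℕ) ⟩
    countᵇ (lowerAdjᴺ i) (tabulate {n = suc n} toℕ)
      ≡⟨ cong (countᵇ (lowerAdjᴺ i)) (tabulate-∘toℕ (suc n) (λ k → k)) ⟩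
    countᵇ (lowerAdjᴺ i) (upTo (suc n))
      ≡⟨ countᵇ-upTo-stable (lowerAdjᴺ-down i) (toℕ i) (suc n) (ℕP.<⇒≤ (FP.toℕ<n i)) (lowerAdjᴺ-self i) ⟩
    countᵇ (lowerAdjᴺ i) (upTo (toℕ i)) ∎
    where open ≡-Reasoning

  lowerNbhd-initial : ∀ i j → ((toℕ j <ᵇ toℕ i) ∧ G i j) ≡ (toℕ j <ᵇ dbar G i)
  lowerNbhd-initial i j =
    trans (cong ((toℕ j <ᵇ toℕ i) ∧_) (sym (adjᴺ-toℕ i j)))
      (trans (DownClosed⇒initial (lowerAdjᴺ-down i) (toℕ i) (lowerAdjᴺ-self i) (toℕ j))
             (cong (toℕ j <ᵇ_) (sym (dbar≡countᵇ-upTo i))))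

  dbar≤toℕ : ∀ i → dbar G i ≤ toℕ i
  dbar≤toℕ i = subst₂ _≤_ (sym (dbar≡countᵇ-upTo i)) (LP.length-upTo (toℕ i))
                      (countᵇ-≤-length (lowerAdjᴺ i) (upTo (toℕ i)))

  dbar-full : ∀ i j → toℕ j < dbar G i → dbar G j ≡ toℕ j
  dbar-full i j j<dᵢ =
    trans (dbar≡countᵇ-upTo j)
      (trans (countᵇ-all (lowerAdjᴺ j) (upTo (toℕ j)) (applyUpTo⁺₁ _ (toℕ j) adjacent)) (LP.length-upTo (toℕ j)))
    where
    lower : ((toℕ j <ᵇ toℕ i) ∧ G i j) ≡ true
    lower = trans (lowerNbhd-initial i j) (<ᵇ-true j<dᵢ)
    j<i = ℕP.<ᵇ⇒< (toℕ j) (toℕ i) (subst T (sym (∧-true-l lower)) _)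
    adjacent : ∀ {k} → k < toℕ j → lowerAdjᴺ j k ≡ true
    adjacent {k} k<j = cong₂ _∧_ (<ᵇ-true k<j)
      (trans (adjᴺ-< j k k<1+n)
             (lower-nbhd-full i j (fromℕ< k<1+n) (subst (_< toℕ j) (sym (FP.toℕ-fromℕ< k<1+n)) k<j) j<i
                              (∧-true-r lower)))
      where k<1+n = ℕP.<-trans k<j (FP.toℕ<n j)

  -- If d̄ᵢ < i then vertex d̄ᵢ < i is not adjacent to i, hence neither is any vertex above i.
  dbar≡deg⊓toℕ : ∀ i → dbar G i ≡ deg G i ⊓ toℕ i
  dbar≡deg⊓toℕ i with ℕP.m≤n⇒m<n∨m≡n (dbar≤toℕ i)
  ... | inj₂ dᵢ≡i = sym (trans (ℕP.m≥n⇒m⊓n≡n i≤deg) (sym dᵢ≡i))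
    where
    i≤deg : toℕ i ≤ deg G i
    i≤deg = subst (_≤ deg G i) dᵢ≡i (countᵇ-mono {p = λ j → (toℕ j <ᵇ toℕ i) ∧ G i j} {r = G i} (λ _ → ∧-true-r) AF)
  ... | inj₁ dᵢ<i = trans (sym deg≡dbar) (sym (ℕP.m≤n⇒m⊓n≡m (ℕP.≤-trans (ℕP.≤-reflexive deg≡dbar) (dbar≤toℕ i))))
    where
    dᵢ<1+n = ℕP.<-trans dᵢ<i (FP.toℕ<n i)
    j₀ = fromℕ< dᵢ<1+n
    toℕ-j₀ : toℕ j₀ ≡ dbar G i
    toℕ-j₀ = FP.toℕ-fromℕ< dᵢ<1+n
    not-j₀ : G i j₀ ≡ false
    not-j₀ with G i j₀ in g
    ... | false = refl
    ... | true = trans (sym (cong₂ _∧_ (trans (cong (_<ᵇ toℕ i) toℕ-j₀) (<ᵇ-true dᵢ<i)) g))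
                       (trans (lowerNbhd-initial i j₀)
                              (trans (cong (_<ᵇ dbar G i) toℕ-j₀) (<ᵇ-false (ℕP.≤-refl {dbar G i}))))
    none-above : ∀ k → toℕ i < toℕ k → G i k ≡ false
    none-above k i<k with G i k in g
    ... | false = refl
    ... | true = trans (sym (nbhd-above⇒below i j₀ k (subst (_< toℕ i) (sym toℕ-j₀) dᵢ<i) i<k g)) not-j₀
    only-below : ∀ j → G i j ≡ ((toℕ j <ᵇ toℕ i) ∧ G i j)
    only-below j with ℕP.<-cmp (toℕ j) (toℕ i)
    ... | tri< j<i _ _ rewrite <ᵇ-true j<i = refl
    ... | tri≈ _ j≡i _ rewrite <ᵇ-false (ℕP.≤-reflexive (sym j≡i)) =
      trans (cong (G i) (FP.toℕ-injective j≡i)) (irrefl-G i)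
    ... | tri> _ _ i<j rewrite <ᵇ-false (ℕP.<⇒≤ i<j) = none-above j i<j
    deg≡dbar : deg G i ≡ dbar G i
    deg≡dbar = countᵇ-cong only-below AF

-- From the Fin-indexed definitions to the staircase model

map-allFin : ∀ {A : Set} N (f : Fin N → A) (g : ℕ → A) → (∀ i → f i ≡ g (toℕ i)) →
  map f (allFin N) ≡ applyUpTo g N
map-allFin N f g f≗g = trans (LP.map-tabulate (λ i → i) f) (trans (LP.tabulate-cong f≗g) (tabulate-∘toℕ N g))

filterᵇ-<ᵇ-upTo : ∀ m N → m ≤ N → filterᵇ (_<ᵇ m) (upTo N) ≡ upTo m
filterᵇ-<ᵇ-upTo zero N _ = LP.filter-none (T? ∘ (_<ᵇ 0)) (All.universal (λ _ ()) (upTo N))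
filterᵇ-<ᵇ-upTo (suc m) (suc N) (s≤s m≤N) = cong (0 ∷_) (begin
  filterᵇ (_<ᵇ suc m) (applyUpTo suc N)     ≡⟨ cong (filterᵇ (_<ᵇ suc m)) (LP.map-upTo suc N) ⟨
  filterᵇ (_<ᵇ suc m) (map suc (upTo N))   ≡⟨ filterᵇ-map (_<ᵇ suc m) suc (upTo N) ⟩
  map suc (filterᵇ (_<ᵇ m) (upTo N))        ≡⟨ cong (map suc) (filterᵇ-<ᵇ-upTo m N m≤N) ⟩
  map suc (upTo m)                          ≡⟨ LP.map-upTo suc m ⟩
  applyUpTo suc m                           ∎)
  where open ≡-Reasoning

sumTo-suc : ∀ n g → sumTo (suc n) g ≡ g 1 ℕ.+ sumTo n (g ∘ suc)
sumTo-suc zero g = ℕP.+-comm 0 (g 1)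
sumTo-suc (suc n) g rewrite sumTo-suc n g = ℕP.+-assoc (g 1) _ _

andTo-suc : ∀ n g → andTo (suc n) g ≡ (g 1 ∧ andTo n (g ∘ suc))
andTo-suc zero g = BP.∧-comm true (g 1)
andTo-suc (suc n) g rewrite andTo-suc n g = BP.∧-assoc (g 1) _ _

prodTo-suc : ∀ n g → prodTo (suc n) g ≡ g 1 ℤ.* prodTo n (g ∘ suc)
prodTo-suc zero g = ℤP.*-comm 1ℤ (g 1)
prodTo-suc (suc n) g rewrite prodTo-suc n g = ℤP.*-assoc (g 1) _ _

sumℕ-applyUpTo : ∀ n (g : ℕ → ℕ) → sumℕ (applyUpTo (g ∘ suc) n) ≡ sumTo n g
sumℕ-applyUpTo zero g = refl
sumℕ-applyUpTo (suc n) g = trans (cong (g 1 ℕ.+_) (sumℕ-applyUpTo n (g ∘ suc))) (sym (sumTo-suc n g))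

and-applyUpTo : ∀ n (g : ℕ → Bool) → and (applyUpTo (g ∘ suc) n) ≡ andTo n g
and-applyUpTo zero g = refl
and-applyUpTo (suc n) g = trans (cong (g 1 ∧_) (and-applyUpTo n (g ∘ suc))) (sym (andTo-suc n g))

prodℤ-applyUpTo : ∀ n (g : ℕ → ℤ) → prodℤ (applyUpTo (g ∘ suc) n) ≡ prodTo n g
prodℤ-applyUpTo zero g = refl
prodℤ-applyUpTo (suc n) g = trans (cong (ℤ._*_ (g 1)) (prodℤ-applyUpTo n (g ∘ suc))) (sym (prodTo-suc n g))

toℕ² : ∀ {N} → Fin N × Fin N → ℕ × ℕ
toℕ² (i , j) = (toℕ i , toℕ j)

outflow≡outflowᴺ : ∀ {N} (fes : List (Fin N × Fin N)) x (k : Fin N) →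
  sumℕ (map proj₂ (filterᵇ (λ e → finEq (proj₁ (proj₁ e)) k) (zip fes x))) ≡ outflowᴺ (map toℕ² fes) x (toℕ k)
outflow≡outflowᴺ [] x k = refl
outflow≡outflowᴺ (_ ∷ _) [] k = refl
outflow≡outflowᴺ ((i , j) ∷ fes) (v ∷ x) k with toℕ i ≡ᵇ toℕ k
... | true = cong (v ℕ.+_) (outflow≡outflowᴺ fes x k)
... | false = outflow≡outflowᴺ fes x k

inflow≡inflowᴺ : ∀ {N} (fes : List (Fin N × Fin N)) x (k : Fin N) →
  sumℕ (map proj₂ (filterᵇ (λ e → finEq (proj₂ (proj₁ e)) k) (zip fes x))) ≡ inflowᴺ (map toℕ² fes) x (toℕ k)
inflow≡inflowᴺ [] x k = refl
inflow≡inflowᴺ (_ ∷ _) [] k = refl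
inflow≡inflowᴺ ((i , j) ∷ fes) (v ∷ x) k with toℕ j ≡ᵇ toℕ k
... | true = cong (v ℕ.+_) (inflow≡inflowᴺ fes x k)
... | false = inflow≡inflowᴺ fes x k

module StaircaseForm (n : ℕ) (G : Graph n)
  (lowerNbhd-initial : ∀ i j → ((toℕ j <ᵇ toℕ i) ∧ G i j) ≡ (toℕ j <ᵇ dbar G i))
  (dbar≤toℕ : ∀ i → dbar G i ≤ toℕ i)
  (dbar-full : ∀ i j → toℕ j < dbar G i → dbar G j ≡ toℕ j)
  (a : Fin n → ℕ) (a-pos : ∀ k → 0 < a k) where

  -- d̄ and a extended by 0 to all of ℕ; Aᴺ (suc k) = a k.
  Dᴺ : ℕ → ℕ
  Dᴺ k with k ℕP.<? suc n
  ... | yes k<1+n = dbar G (fromℕ< k<1+n)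
  ... | no _ = 0

  Aᴺ : ℕ → ℕ
  Aᴺ zero = 0
  Aᴺ (suc k) with k ℕP.<? n
  ... | yes k<n = a (fromℕ< k<n)
  ... | no _ = 0

  Dᴺ-toℕ : ∀ i → Dᴺ (toℕ i) ≡ dbar G i
  Dᴺ-toℕ i with toℕ i ℕP.<? suc n
  ... | yes i<1+n = cong (dbar G) (FP.fromℕ<-toℕ i i<1+n)
  ... | no i≮1+n = ⊥-elim (i≮1+n (FP.toℕ<n i))

  Aᴺ-toℕ : ∀ i → Aᴺ (suc (toℕ i)) ≡ a i
  Aᴺ-toℕ i with toℕ i ℕP.<? n
  ... | yes i<n = cong a (FP.fromℕ<-toℕ i i<n)
  ... | no i≮n = ⊥-elim (i≮n (FP.toℕ<n i))

  Aᴺ-pos : ∀ {k} → InRange n k → 0 < Aᴺ k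
  Aᴺ-pos {suc k} (_ , k<n) with k ℕP.<? n
  ... | yes k<n′ = a-pos (fromℕ< k<n′)
  ... | no k≮n = ⊥-elim (k≮n k<n)

  Dᴺ-below : ∀ k → Dᴺ k ≤ k
  Dᴺ-below k with k ℕP.<? suc n
  ... | yes k<1+n = subst (dbar G (fromℕ< k<1+n) ≤_) (FP.toℕ-fromℕ< k<1+n) (dbar≤toℕ (fromℕ< k<1+n))
  ... | no _ = z≤n

  Dᴺ-full : ∀ {k j} → k ≤ n → 0 < j → j < Dᴺ k → Dᴺ j ≡ j
  Dᴺ-full {k} {j} k≤n _ j<Dₖ with k ℕP.<? suc n
  ... | no k≮1+n = ⊥-elim (k≮1+n (s≤s k≤n))
  ... | yes k<1+n = begin
    Dᴺ j              ≡⟨ cong Dᴺ toℕ-j′ ⟨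
    Dᴺ (toℕ j′)       ≡⟨ Dᴺ-toℕ j′ ⟩
    dbar G j′         ≡⟨ dbar-full (fromℕ< k<1+n) j′ (subst (_< dbar G (fromℕ< k<1+n)) (sym toℕ-j′) j<Dₖ) ⟩
    toℕ j′            ≡⟨ toℕ-j′ ⟩
    j                 ∎
    where
    open ≡-Reasoning
    j<1+n : j < suc n
    j<1+n = ℕP.<-≤-trans j<Dₖ (ℕP.≤-trans (dbar≤toℕ (fromℕ< k<1+n))
                                          (ℕP.≤-trans (ℕP.≤-reflexive (FP.toℕ-fromℕ< k<1+n)) (ℕP.m≤n⇒m≤1+n k≤n)))
    j′ = fromℕ< j<1+n
    toℕ-j′ : toℕ j′ ≡ j
    toℕ-j′ = FP.toℕ-fromℕ< j<1+n

  staircaseᴰ : IsStaircase n Dᴺ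
  staircaseᴰ = record { below = Dᴺ-below ; full = Dᴺ-full }

  starᴺ : ℕ → List (ℕ × ℕ)
  starᴺ k = map (λ j → (k , j)) (upTo (Dᴺ k))

  concatMap-starᴺ : ∀ m → concatMap starᴺ (applyUpTo suc m) ≡ staircase Dᴺ m
  concatMap-starᴺ zero = refl
  concatMap-starᴺ (suc m) = begin
    concatMap starᴺ (applyUpTo suc (suc m))            ≡⟨ cong (concatMap starᴺ) (LP.applyUpTo-∷ʳ suc m) ⟨
    concatMap starᴺ (applyUpTo suc m ++ suc m ∷ [])    ≡⟨ LP.concatMap-++ starᴺ (applyUpTo suc m) (suc m ∷ []) ⟩
    concatMap starᴺ (applyUpTo suc m) ++ (starᴺ (suc m) ++ [])
                                                       ≡⟨ cong₂ _++_ (concatMap-starᴺ m) (LP.++-identityʳ (starᴺ (suc m))) ⟩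
    staircase Dᴺ m ++ starᴺ (suc m)                    ∎
    where open ≡-Reasoning

  lowerEdges≡starᴺ : ∀ i →
    map toℕ² (map (λ j → (i , j)) (filterᵇ (λ j → (toℕ j <ᵇ toℕ i) ∧ G i j) (allFin (suc n)))) ≡ starᴺ (toℕ i)
  lowerEdges≡starᴺ i = begin
    map toℕ² (map (i ,_) (filterᵇ (λ j → (toℕ j <ᵇ toℕ i) ∧ G i j) (allFin (suc n))))
      ≡⟨ LP.map-∘ (filterᵇ (λ j → (toℕ j <ᵇ toℕ i) ∧ G i j) (allFin (suc n))) ⟨
    map (λ j → (toℕ i , toℕ j)) (filterᵇ (λ j → (toℕ j <ᵇ toℕ i) ∧ G i j) (allFin (suc n)))
      ≡⟨ cong (map (λ j → (toℕ i , toℕ j))) (filterᵇ-cong (lowerNbhd-initial i) (allFin (suc n))) ⟩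
    map (λ j → (toℕ i , toℕ j)) (filterᵇ ((_<ᵇ dbar G i) ∘ toℕ) (allFin (suc n)))
      ≡⟨ LP.map-∘ (filterᵇ ((_<ᵇ dbar G i) ∘ toℕ) (allFin (suc n))) ⟩
    map (toℕ i ,_) (map toℕ (filterᵇ ((_<ᵇ dbar G i) ∘ toℕ) (allFin (suc n))))
      ≡⟨ cong (map (toℕ i ,_)) (filterᵇ-map (_<ᵇ dbar G i) toℕ (allFin (suc n))) ⟨
    map (toℕ i ,_) (filterᵇ (_<ᵇ dbar G i) (map toℕ (allFin (suc n))))
      ≡⟨ cong (λ ks → map (toℕ i ,_) (filterᵇ (_<ᵇ dbar G i) ks)) (map-allFin (suc n) toℕ (λ k → k) (λ _ → refl)) ⟩
    map (toℕ i ,_) (filterᵇ (_<ᵇ dbar G i) (upTo (suc n)))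
      ≡⟨ cong (map (toℕ i ,_)) (filterᵇ-<ᵇ-upTo (dbar G i) (suc n) (ℕP.≤-trans (dbar≤toℕ i) (ℕP.<⇒≤ (FP.toℕ<n i)))) ⟩
    map (toℕ i ,_) (upTo (dbar G i))
      ≡⟨ cong (map (toℕ i ,_) ∘ upTo) (Dᴺ-toℕ i) ⟨
    starᴺ (toℕ i) ∎
    where open ≡-Reasoning

  edges≡staircase : map toℕ² (edges G) ≡ staircase Dᴺ n
  edges≡staircase = begin
    map toℕ² (edges G)
      ≡⟨ LP.map-concatMap toℕ² _ (allFin (suc n)) ⟩
    concat (map _ (allFin (suc n)))
      ≡⟨ cong concat (map-allFin (suc n) _ starᴺ lowerEdges≡starᴺ) ⟩
    concat (applyUpTo starᴺ (suc n))
      ≡⟨ cong₂ (λ t r → map (0 ,_) (upTo t) ++ concat r) D₀≡0 (sym (LP.map-applyUpTo suc starᴺ n)) ⟩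
    concatMap starᴺ (applyUpTo suc n)
      ≡⟨ concatMap-starᴺ n ⟩
    staircase Dᴺ n ∎
    where
    open ≡-Reasoning
    D₀≡0 : Dᴺ 0 ≡ 0
    D₀≡0 = ℕP.n≤0⇒n≡0 (Dᴺ-below 0)

  length-edges : length (edges G) ≡ length (staircase Dᴺ n)
  length-edges = trans (sym (LP.length-map toℕ² (edges G))) (cong length edges≡staircase)

  sum-a : sumℕ (map a (allFin n)) ≡ sumTo n Aᴺ
  sum-a = trans (cong sumℕ (map-allFin n a (Aᴺ ∘ suc) (λ i → sym (Aᴺ-toℕ i)))) (sumℕ-applyUpTo n Aᴺ)

  outflow≡ : ∀ x k → outflow G x k ≡ outflowᴺ (staircase Dᴺ n) x (toℕ k)
  outflow≡ x k = trans (outflow≡outflowᴺ (edges G) x k) (cong (λ es → outflowᴺ es x (toℕ k)) edges≡staircase)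

  inflow≡ : ∀ x k → inflow G x k ≡ inflowᴺ (staircase Dᴺ n) x (toℕ k)
  inflow≡ x k = trans (inflow≡inflowᴺ (edges G) x k) (cong (λ es → inflowᴺ es x (toℕ k)) edges≡staircase)

  isFlowᵇ≡isFlowᴺ : ∀ x → length x ≡ length (edges G) → isFlowᵇ G a x ≡ isFlowᴺ n Aᴺ (staircase Dᴺ n) x
  isFlowᵇ≡isFlowᴺ x |x| rewrite ≡ᵇ-true |x| =
    cong₂ _∧_ (cong₂ _≡ᵇ_ (cong₂ ℕ._+_ (outflow≡ x F.zero) sum-a) (inflow≡ x F.zero))
              (trans (cong and (map-allFin n _ (conservation ∘ suc)
                                  (λ i → cong₂ _≡ᵇ_ (outflow≡ x (F.suc i))
                                                   (cong₂ ℕ._+_ (inflow≡ x (F.suc i)) (sym (Aᴺ-toℕ i))))))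
                     (and-applyUpTo n conservation))
    where
    conservation : ℕ → Bool
    conservation k = outflowᴺ (staircase Dᴺ n) x k ≡ᵇ inflowᴺ (staircase Dᴺ n) x k ℕ.+ Aᴺ k

  rhs≡rhsᴺ : ∀ q → rhs G a q ≡ rhsᴺ q n Dᴺ Aᴺ
  rhs≡rhsᴺ q =
    trans (cong prodℤ (map-allFin n _ (factor ∘ suc)
                         (λ i → cong₂ (λ u v → q ℤ.^ (u ℕ.* (v ∸ 1)) ℤ.* qint q u)
                                      (sym (Dᴺ-toℕ (F.suc i))) (sym (Aᴺ-toℕ i)))))
          (prodℤ-applyUpTo n factor)
    where
    factor : ℕ → ℤ
    factor k = q ℤ.^ (Dᴺ k ℕ.* (Aᴺ k ∸ 1)) ℤ.* qint q (Dᴺ k)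

  -- Ehr0 filters the box; the staircase sum keeps the box and zeroes the non-flows.
  Ehr0≡ehrᴺ : ∀ q → Ehr0 G a q ≡ ehrᴺ q n Dᴺ Aᴺ 0 (sumTo n Aᴺ)
  Ehr0≡ehrᴺ q = begin
    ∑ (wtFlow0 n q) (filterᵇ (isFlowᵇ G a) (box B (length (edges G))))
      ≡⟨ ∑-filter (isFlowᵇ G a) (wtFlow0 n q) (box B (length (edges G))) ⟩
    ∑ (λ x → if isFlowᵇ G a x then wtFlow0 n q x else 0ℤ) (box B (length (edges G)))
      ≡⟨ ∑-congᴬ (All.map (λ {x} |x| → cong₂ (λ b w → if b then w else 0ℤ) (isFlowᵇ≡isFlowᴺ x |x|)
                                             (cong (λ t → c q ℤ.^ (t ∸ n) ℤ.* wtProd q x)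
                                                   (sym (ℕP.+-identityʳ (positives x)))))
                          (box-length B (length (edges G)))) ⟩
    ∑ (λ x → if isFlowᴺ n Aᴺ (staircase Dᴺ n) x then flowWt q n 0 x else 0ℤ) (box B (length (edges G)))
      ≡⟨ cong₂ (λ b m → ∑ (λ x → if isFlowᴺ n Aᴺ (staircase Dᴺ n) x then flowWt q n 0 x else 0ℤ) (box b m))
               sum-a length-edges ⟩
    ehrᴺ q n Dᴺ Aᴺ 0 (sumTo n Aᴺ) ∎
    where
    open ≡-Reasoning
    B = sumℕ (map a (allFin n))

  Ehr0≡rhs : ∀ q → Ehr0 G a q ≡ rhs G a q
  Ehr0≡rhs q = begin
    Ehr0 G a q                     ≡⟨ Ehr0≡ehrᴺ q ⟩
    ehrᴺ q n Dᴺ Aᴺ 0 (sumTo n Aᴺ)  ≡⟨ ehrᴺ-closed q n Dᴺ Aᴺ Aᴺ-pos staircaseᴰ 0 (sumTo n Aᴺ) ℕP.≤-refl ⟩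
    1ℤ ℤ.* rhsᴺ q n Dᴺ Aᴺ          ≡⟨ ℤP.*-identityˡ _ ⟩
    rhsᴺ q n Dᴺ Aᴺ                 ≡⟨ rhs≡rhsᴺ q ⟨
    rhs G a q                      ∎
    where open ≡-Reasoning

theorem4p2 : (n : ℕ) (G : Graph n) →
    (∀ i j → G i j ≡ G j i) → (∀ i → G i i ≡ false) →
    IsThreshold G → ReverseDegreeLabeled G →
    (a : Fin n → ℕ) → (∀ k → 0 < a k) →
    (∀ (q : ℤ) → Ehr0 G a q ≡ rhs G a q)
    × (∀ (i : Fin (suc n)) → dbar G i ≡ deg G i ⊓ toℕ i)
theorem4p2 n G sym-G irrefl-G threshold labeled a a-pos =
  StaircaseForm.Ehr0≡rhs n G lowerNbhd-initial dbar≤toℕ dbar-full a a-pos , dbar≡deg⊓toℕ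
  where open ReverseDegreeThreshold n G sym-G irrefl-G threshold labeled
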